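{- Let $k$ be a field, $A$ a countable set, $\diamond$ a commutative associative product on $kA$, and $r\in k$. The interpolated product $\overset{r}{*}$ on $k\langle A\rangle$ satisfies $1\overset{r}{*}w=w\overset{r}{*}1=w$ for every word $w$, $a\overset{r}{*}b=ab+ba+(1-2r)\,a\diamond b$ for all letters $a,b$, and \[ av\overset{r}{*}bw=a(v\overset{r}{*}bw)+b(av\overset{r}{*}w)+(1-2r)(a\diamond b)(v\overset{r}{*}w)+(r^2-r)(a\diamond b)\diamond(v\overset{r}{*}w) \] for all letters $a,b$ and words $v,w$ with $vw\neq1$; in particular $\overset{r}{*}$ is the unique $k$-bilinear product satisfying these rules.
   Context: $k\langle A\rangle$ is the algebra of words in $A$. The quasi-shuffle product $*$ is the bilinear product with $1*w=w*1=w$ and $(aw)*(bv)=a(w*bv)+b(aw*v)+(a\diamond b)(w*v)$. For a composition $I=(i_1,\dots,i_m)$ of $n$ and a word $w=a_1\cdots a_n$, $I[w]=(a_1\diamond\cdots\diamond a_{i_1})\cdots(a_{i_1+\dots+i_{m-1}+1}\diamond\cdots\diamond a_n)$. For $s\in k$, $\Sigma^s(w)=\sum_I s^{\ell(w)-m}I[w]$ over compositions $I$ of $\ell(w)$ with $m$ parts; $\Sigma^{ -r}$ is inverse to $\Sigma^r$. The interpolated product is $u\overset{r}{*}v=\Sigma^{ -r}(\Sigma^ru*\Sigma^rv)$. For a letter $a$ and a nonempty word $u=cu'$, $a\diamond u=(a\diamond c)u'$, extended linearly. -}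

module Defs where

open import Level using (Level; _⊔_) renaming (suc to lsuc)
open import Algebra.Bundles using (CommutativeRing)
open import Data.Nat as ℕ using (ℕ; suc; _∸_)
open import Data.List using (List; []; _∷_; _++_; map; concatMap; length; splitAt; foldr)
open import Data.List.Properties using (≡-dec)
open import Data.Product using (Σ; _×_; _,_; proj₁; proj₂)
open import Relation.Nullary using (¬_; yes; no)
open import Relation.Binary.Definitions using (DecidableEquality)
open import Relation.Binary.PropositionalEquality using (_≡_; refl)
open import Function.Definitions using (Injective)

record Field (c ℓ : Level) : Set (lsuc (c ⊔ ℓ)) where
  field
    commutativeRing : CommutativeRing c ℓ
  open CommutativeRing commutativeRing public
  field
    0≉1     : ¬ (0# ≈ 1#)
    inverse : ∀ x → ¬ (x ≈ 0#) → Σ Carrier λ y → x * y ≈ 1#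

-- A countable set: a type with an injection into ℕ.
-- Decidable equality follows from countability.

countable-dec : ∀ {a} {A : Set a} (ι : A → ℕ) → Injective _≡_ _≡_ ι → DecidableEquality A
countable-dec ι inj x y with ι x ℕ.≟ ι y
... | yes p = yes (inj p)
... | no ¬p = no λ { refl → ¬p refl }

-- The setting: field K, countable alphabet A, and a product ◇ on kA,
-- given on basis letters (its bilinear extension is diaA below).

module Interp {c ℓ a : Level} (F : Field c ℓ) (A : Set a)
              (ι : A → ℕ) (ι-inj : Injective _≡_ _≡_ ι)
              (_◇_ : A → A → List (Field.Carrier F × A)) where

  open Field F

  Word : Set a
  Word = List A

  _≟W_ : DecidableEquality Word
  _≟W_ = ≡-dec (countable-dec ι ι-inj)

  _≟A_ : DecidableEquality A
  _≟A_ = countable-dec ι ι-inj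

  -- Elements of kA: formal finite linear combinations of letters.
  LinA : Set (c ⊔ a)
  LinA = List (Carrier × A)

  -- Elements of k⟨A⟩: formal finite linear combinations of words.
  Lin : Set (c ⊔ a)
  Lin = List (Carrier × Word)

  coeffA : LinA → A → Carrier
  coeffA [] x = 0#
  coeffA ((k , y) ∷ p) x with y ≟A x
  ... | yes _ = k + coeffA p x
  ... | no  _ = coeffA p x

  coeff : Lin → Word → Carrier
  coeff [] w = 0#
  coeff ((k , u) ∷ p) w with u ≟W w
  ... | yes _ = k + coeff p w
  ... | no  _ = coeff p w

  -- equality in kA and in k⟨A⟩: equal coefficients on every basis element
  _≈A_ : LinA → LinA → Set (a ⊔ ℓ)
  p ≈A q = ∀ x → coeffA p x ≈ coeffA q x

  _≈L_ : Lin → Lin → Set (a ⊔ ℓ)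
  p ≈L q = ∀ w → coeff p w ≈ coeff q w

  ⟦_⟧ : Word → Lin
  ⟦ w ⟧ = (1# , w) ∷ []

  scale : Carrier → Lin → Lin
  scale k = map (λ { (d , u) → (k * d , u) })

  linExt : (Word → Lin) → Lin → Lin
  linExt f = concatMap (λ { (k , u) → scale k (f u) })

  bilExt : (Word → Word → Lin) → Lin → Lin → Lin
  bilExt f p q = concatMap (λ { (k , u) → concatMap (λ { (d , v) → scale (k * d) (f u v) }) q }) p

  diaA : LinA → LinA → LinA
  diaA p q = concatMap (λ { (k , x) → concatMap (λ { (d , y) →
               map (λ { (e , z) → (k * d * e , z) }) (x ◇ y) }) q }) p

  prepend : A → Lin → Lin
  prepend x = map (λ { (k , u) → (k , x ∷ u) })

  prependA : LinA → Lin → Lin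
  prependA ξ p = concatMap (λ { (k , x) → scale k (prepend x p) }) ξ

  liftA : LinA → Lin
  liftA ξ = prependA ξ ⟦ [] ⟧

  -- a ◇ u = (a ◇ c) u' for u = c u'  (a ◇ 1 := 0, never used in the theorem)
  letterDiaWord : A → Word → Lin
  letterDiaWord x []       = []
  letterDiaWord x (y ∷ u) = prependA (x ◇ y) ⟦ u ⟧

  diaAL : LinA → Lin → Lin
  diaAL ξ p = concatMap (λ { (k , x) → scale k (linExt (letterDiaWord x) p) }) ξ

  qsh : Word → Word → Lin
  qsh []       v        = ⟦ v ⟧
  qsh (x ∷ u) []        = ⟦ x ∷ u ⟧
  qsh (x ∷ u) (y ∷ v) = prepend x (qsh u (y ∷ v))
                        ++ prepend y (qsh (x ∷ u) v)
                        ++ prependA (x ◇ y) (qsh u v)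

  _⋆_ : Lin → Lin → Lin
  _⋆_ = bilExt qsh

  -- compositions of n (lists of positive integers summing to n)
  compositions : ℕ → List (List ℕ)
  compositions ℕ.zero    = [] ∷ []
  compositions (suc n) = map (1 ∷_) (compositions n) ++ concatMap incrHead (compositions n)
    where
      incrHead : List ℕ → List (List ℕ)
      incrHead []       = []
      incrHead (i ∷ I) = (suc i ∷ I) ∷ []

  -- a₁ ◇ ⋯ ◇ aⱼ  as an element of kA (the empty block gives 0; it never occurs)
  block : Word → LinA
  block []       = []
  block (x ∷ []) = (1# , x) ∷ []
  block (x ∷ u)  = diaA ((1# , x) ∷ []) (block u)

  applyComp : List ℕ → Word → Lin
  applyComp []       w = ⟦ [] ⟧
  applyComp (i ∷ I) w = prependA (block (proj₁ (splitAt i w))) (applyComp I (proj₂ (splitAt i w)))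

  _^_ : Carrier → ℕ → Carrier
  s ^ ℕ.zero  = 1#
  s ^ suc n   = s * (s ^ n)

  Σw : Carrier → Word → Lin
  Σw s w = concatMap (λ I → scale (s ^ (length w ∸ length I)) (applyComp I w))
                     (compositions (length w))

  Σ^ : Carrier → Lin → Lin
  Σ^ s = linExt (Σw s)

  istar : Carrier → Word → Word → Lin
  istar r u v = Σ^ (- r) (Σw r u ⋆ Σw r v)

  record Rules (r : Carrier) (P : Word → Word → Lin) : Set (a ⊔ ℓ) where
    field
      unitˡ  : ∀ w → P [] w ≈L ⟦ w ⟧
      unitʳ  : ∀ w → P w [] ≈L ⟦ w ⟧
      letters : ∀ x y → P (x ∷ []) (y ∷ [])
                  ≈L (⟦ x ∷ y ∷ [] ⟧ ++ ⟦ y ∷ x ∷ [] ⟧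
                      ++ scale (1# - (r + r)) (liftA (x ◇ y)))
      recur  : ∀ x y v w → ¬ (v ++ w ≡ []) →
               P (x ∷ v) (y ∷ w)
                  ≈L (prepend x (P v (y ∷ w))
                      ++ prepend y (P (x ∷ v) w)
                      ++ scale (1# - (r + r)) (prependA (x ◇ y) (P v w))
                      ++ scale (r * r - r) (diaAL (x ◇ y) (P v w)))

module Submission where

-- Let ⊛ be the product defined by the rules, by recursion on the words; any
-- product obeying the rules equals ⊛ by the same recursion.  Since Σ^{-r} is
-- inverse to Σ^r, it remains to show Σ^r(u ⊛ v) = Σ^r u * Σ^r v, by induction.
-- This rests on: (1) Σ^s(ξ X) = ξ Σ^s X + s ξ ◇ Σ^s X and Σ^s(ξ ◇ X) = ξ ◇ Σ^s X,
-- obtained by splitting compositions according to their first part; (2) the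
-- quasi-shuffle recursion for combinations ξ X, η Y with first letters ξ, η ∈ kA;
-- (3) a key identity for S a V * S b W, where S a V = a V + r a ◇ V, whose
-- coefficients match because of the constants 1 - 2r and r² - r.

open import Defs
open import Level using (Level; _⊔_)
open import Data.Nat using (ℕ)
open import Data.List using (List; []; _∷_)
open import Data.Product using (_×_; _,_)
open import Relation.Binary.PropositionalEquality using (_≡_)
open import Function.Definitions using (Injective)

open import Algebra.Bundles using (CommutativeRing)
import Data.Nat as Nat
open Nat using (zero; suc; _∸_)
import Data.Nat.Properties as NatP
open import Data.List using (_++_; map; concatMap; length; splitAt)
import Data.List.Properties as LP
open import Data.Product using (proj₁; proj₂)
open import Data.Empty using (⊥-elim)
import Data.Integer as ℤ
import Data.Integer.Properties as ℤP
open import Data.Sign as Sign using (Sign)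
open import Data.Maybe using (just; nothing)
open import Data.Unit using (⊤; tt)
open import Data.List.Relation.Unary.All as All using (All; []; _∷_)
import Data.List.Relation.Unary.All.Properties as AllP
open import Relation.Nullary using (yes; no)
open import Relation.Binary.Bundles using (Setoid)
open import Relation.Binary.Definitions using (DecidableEquality)
import Relation.Binary.PropositionalEquality as ≡
open ≡ using (_≢_)
import Relation.Binary.Reasoning.Setoid as SetoidReasoning

-- It makes
-- the standard library's ring solver available for identities in R with
-- integer coefficients, such as those involving 1 - 2r and r² - r below.
module IntegerCoefficients {c ℓ} (R : CommutativeRing c ℓ) where
  open CommutativeRing R
  open ℤ using (ℤ; +_; -[1+_]; _⊖_)
  open import Algebra.Properties.Ring ring
    using (-‿distribˡ-*; -‿distribʳ-*; -‿involutive; -0#≈0#; -‿anti-homo-+)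
  open import Algebra.Properties.Monoid.Mult.TCOptimised +-monoid
    using (×-homo-+; 1+×) renaming (_×_ to _×′_)
  open import Algebra.Properties.Semiring.Mult.TCOptimised semiring using (×1-homo-*)
  open import Algebra.Solver.Ring.AlmostCommutativeRing
    using (fromCommutativeRing; _-Raw-AlmostCommutative⟶_; Induced-equivalence)
  open import Relation.Binary.Definitions using (WeaklyDecidable)
  open import Relation.Binary.Reasoning.Setoid setoid

  -- n ↦ n·1 (the optimised multiple, so that 1 ↦ 1# definitionally)
  ⟦_⟧ℤ : ℤ → Carrier
  ⟦ + n ⟧ℤ      = n ×′ 1#
  ⟦ -[1+ n ] ⟧ℤ = - (suc n ×′ 1#)

  cancel-+ : ∀ o x y → (o + x) - (o + y) ≈ x - y
  cancel-+ o x y = begin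
    (o + x) + - (o + y)    ≈⟨ +-congˡ (-‿anti-homo-+ o y) ⟩
    (o + x) + (- y + - o)  ≈⟨ +-assoc o x _ ⟩
    o + (x + (- y + - o))  ≈⟨ +-congˡ (sym (+-assoc x _ _)) ⟩
    o + ((x + - y) + - o)  ≈⟨ +-congˡ (+-comm _ (- o)) ⟩
    o + (- o + (x + - y))  ≈⟨ sym (+-assoc _ _ _) ⟩
    (o + - o) + (x + - y)  ≈⟨ +-congʳ (-‿inverseʳ o) ⟩
    0# + (x + - y)         ≈⟨ +-identityˡ _ ⟩
    x + - y                ∎

  ⟦⊖⟧ : ∀ m n → ⟦ m ⊖ n ⟧ℤ ≈ m ×′ 1# - n ×′ 1#
  ⟦⊖⟧ zero    zero    = sym (-‿inverseʳ 0#)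
  ⟦⊖⟧ (suc m) zero    = sym (trans (+-congˡ -0#≈0#) (+-identityʳ _))
  ⟦⊖⟧ zero    (suc n) = sym (+-identityˡ _)
  ⟦⊖⟧ (suc m) (suc n) = begin
    ⟦ suc m ⊖ suc n ⟧ℤ               ≡⟨ ≡.cong ⟦_⟧ℤ (ℤP.[1+m]⊖[1+n]≡m⊖n m n) ⟩
    ⟦ m ⊖ n ⟧ℤ                       ≈⟨ ⟦⊖⟧ m n ⟩
    m ×′ 1# - n ×′ 1#                ≈⟨ cancel-+ 1# _ _ ⟨
    (1# + m ×′ 1#) - (1# + n ×′ 1#)  ≈⟨ +-cong (1+× m 1#) (-‿cong (1+× n 1#)) ⟨
    suc m ×′ 1# - suc n ×′ 1#        ∎

  ⟦+⟧ : ∀ i j → ⟦ i ℤ.+ j ⟧ℤ ≈ ⟦ i ⟧ℤ + ⟦ j ⟧ℤ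
  ⟦+⟧ (+ m)    (+ n)    = ×-homo-+ 1# m n
  ⟦+⟧ (+ m)    -[1+ n ] = ⟦⊖⟧ m (suc n)
  ⟦+⟧ -[1+ m ] (+ n)    = trans (⟦⊖⟧ n (suc m)) (+-comm _ _)
  ⟦+⟧ -[1+ m ] -[1+ n ] = begin
    - (suc (suc (m Nat.+ n)) ×′ 1#)      ≡⟨ ≡.cong (λ k → - (suc k ×′ 1#)) (NatP.+-suc m n) ⟨
    - ((suc m Nat.+ suc n) ×′ 1#)        ≈⟨ -‿cong (×-homo-+ 1# (suc m) (suc n)) ⟩
    - (suc m ×′ 1# + suc n ×′ 1#)        ≈⟨ -‿anti-homo-+ _ _ ⟩
    - (suc n ×′ 1#) + - (suc m ×′ 1#)    ≈⟨ +-comm _ _ ⟩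
    - (suc m ×′ 1#) + - (suc n ×′ 1#)    ∎

  -- products are handled through the decomposition i = sign i ◃ ∣ i ∣
  signed : Sign → Carrier → Carrier
  signed Sign.+ x = x
  signed Sign.- x = - x

  ⟦◃⟧ : ∀ s n → ⟦ s ℤ.◃ n ⟧ℤ ≈ signed s (n ×′ 1#)
  ⟦◃⟧ Sign.+ zero    = refl
  ⟦◃⟧ Sign.- zero    = sym -0#≈0#
  ⟦◃⟧ Sign.+ (suc n) = refl
  ⟦◃⟧ Sign.- (suc n) = refl

  ⟦⟧-signAbs : ∀ i → ⟦ i ⟧ℤ ≈ signed (ℤ.sign i) (ℤ.∣ i ∣ ×′ 1#)
  ⟦⟧-signAbs (+ n)    = refl
  ⟦⟧-signAbs -[1+ n ] = refl

  signed-* : ∀ s t x y → signed (s Sign.* t) (x * y) ≈ signed s x * signed t y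
  signed-* Sign.+ Sign.+ x y = refl
  signed-* Sign.+ Sign.- x y = -‿distribʳ-* x y
  signed-* Sign.- Sign.+ x y = -‿distribˡ-* x y
  signed-* Sign.- Sign.- x y = begin
    x * y            ≈⟨ -‿involutive _ ⟨
    - - (x * y)      ≈⟨ -‿cong (-‿distribʳ-* x y) ⟩
    - (x * - y)      ≈⟨ -‿distribˡ-* x (- y) ⟩
    - x * - y        ∎

  signed-cong : ∀ s {x y} → x ≈ y → signed s x ≈ signed s y
  signed-cong Sign.+ e = e
  signed-cong Sign.- e = -‿cong e

  ⟦*⟧ : ∀ i j → ⟦ i ℤ.* j ⟧ℤ ≈ ⟦ i ⟧ℤ * ⟦ j ⟧ℤ
  ⟦*⟧ i j = begin
    ⟦ (s Sign.* t) ℤ.◃ (m Nat.* n) ⟧ℤ          ≈⟨ ⟦◃⟧ (s Sign.* t) (m Nat.* n) ⟩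
    signed (s Sign.* t) ((m Nat.* n) ×′ 1#)    ≈⟨ signed-cong (s Sign.* t) (×1-homo-* m n) ⟩
    signed (s Sign.* t) (m ×′ 1# * n ×′ 1#)    ≈⟨ signed-* s t _ _ ⟩
    signed s (m ×′ 1#) * signed t (n ×′ 1#)    ≈⟨ *-cong (⟦⟧-signAbs i) (⟦⟧-signAbs j) ⟨
    ⟦ i ⟧ℤ * ⟦ j ⟧ℤ                            ∎
    where
    s = ℤ.sign i
    t = ℤ.sign j
    m = ℤ.∣ i ∣
    n = ℤ.∣ j ∣

  ⟦-⟧ : ∀ i → ⟦ ℤ.- i ⟧ℤ ≈ - ⟦ i ⟧ℤ
  ⟦-⟧ (+ zero)  = sym -0#≈0#
  ⟦-⟧ (+ suc n) = refl
  ⟦-⟧ -[1+ n ]  = sym (-‿involutive _)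

  homomorphism : ℤ.+-*-rawRing -Raw-AlmostCommutative⟶ fromCommutativeRing R
  homomorphism = record
    { ⟦_⟧ = ⟦_⟧ℤ ; +-homo = ⟦+⟧ ; *-homo = ⟦*⟧ ; -‿homo = ⟦-⟧ ; 0-homo = refl ; 1-homo = refl }

  coefficient≟ : WeaklyDecidable (Induced-equivalence homomorphism)
  coefficient≟ i j with i ℤ.≟ j
  ... | yes ≡.refl = just refl
  ... | no _       = nothing

  open import Algebra.Solver.Ring ℤ.+-*-rawRing (fromCommutativeRing R) homomorphism coefficient≟
    public using (Polynomial; solve; _:=_; _:+_; _:*_; _:-_; :-_; con)

  0ₚ 1ₚ : ∀ {n} → Polynomial n
  0ₚ = con (+ 0)
  1ₚ = con (+ 1)

module FormalCombinations {c ℓ} (R : CommutativeRing c ℓ) where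
  open CommutativeRing R

  module Combinations {b} {B : Set b} (_≟_ : DecidableEquality B) where

    Comb : Set (c ⊔ b)
    Comb = List (Carrier × B)

    coeffOf : Comb → B → Carrier
    coeffOf []            w = 0#
    coeffOf ((k , u) ∷ X) w with u ≟ w
    ... | yes _ = k + coeffOf X w
    ... | no  _ = coeffOf X w

    infix 4 _≋_
    record _≋_ (X Y : Comb) : Set (b ⊔ ℓ) where
      constructor mk≋
      field coeff≈ : ∀ w → coeffOf X w ≈ coeffOf Y w
    open _≋_ public

    ≋-refl : ∀ {X} → X ≋ X
    ≋-refl = mk≋ λ _ → refl

    ≋-sym : ∀ {X Y} → X ≋ Y → Y ≋ X
    ≋-sym e = mk≋ λ w → sym (coeff≈ e w)

    ≋-trans : ∀ {X Y Z} → X ≋ Y → Y ≋ Z → X ≋ Z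
    ≋-trans e e′ = mk≋ λ w → trans (coeff≈ e w) (coeff≈ e′ w)

    ≋-reflexive : ∀ {X Y} → X ≡ Y → X ≋ Y
    ≋-reflexive ≡.refl = ≋-refl

    ≋-setoid : Setoid (c ⊔ b) (b ⊔ ℓ)
    ≋-setoid = record { Carrier = Comb ; _≈_ = _≋_
                      ; isEquivalence = record { refl = ≋-refl ; sym = ≋-sym ; trans = ≋-trans } }

    module ≋-Reasoning = SetoidReasoning ≋-setoid

    [_] : B → Comb
    [ u ] = (1# , u) ∷ []

    infixr 7 _·_
    _·_ : Carrier → Comb → Comb
    k · X = map (λ (d , u) → (k * d , u)) X

    coeff-there : ∀ k u X {w} → u ≢ w → coeffOf ((k , u) ∷ X) w ≈ coeffOf X w
    coeff-there k u X {w} u≢w with u ≟ w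
    ... | yes u≡w = ⊥-elim (u≢w u≡w)
    ... | no  _   = refl

    coeff-++ : ∀ X Y w → coeffOf (X ++ Y) w ≈ coeffOf X w + coeffOf Y w
    coeff-++ []            Y w = sym (+-identityˡ _)
    coeff-++ ((k , u) ∷ X) Y w with u ≟ w
    ... | yes _ = trans (+-congˡ (coeff-++ X Y w)) (sym (+-assoc _ _ _))
    ... | no  _ = coeff-++ X Y w

    coeff-· : ∀ k X w → coeffOf (k · X) w ≈ k * coeffOf X w
    coeff-· k []            w = sym (zeroʳ k)
    coeff-· k ((d , u) ∷ X) w with u ≟ w
    ... | yes _ = trans (+-congˡ (coeff-· k X w)) (sym (distribˡ k d _))
    ... | no  _ = coeff-· k X w

    ∷-cong : ∀ {k k′ u X Y} → k ≈ k′ → X ≋ Y → ((k , u) ∷ X) ≋ ((k′ , u) ∷ Y)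
    ∷-cong {u = u} k≈k′ X≋Y = mk≋ λ w → lemma w
      where
      lemma : ∀ w → coeffOf ((_ , u) ∷ _) w ≈ coeffOf ((_ , u) ∷ _) w
      lemma w with u ≟ w
      ... | yes _ = +-cong k≈k′ (coeff≈ X≋Y w)
      ... | no  _ = coeff≈ X≋Y w

    ++-cong : ∀ {X X′ Y Y′} → X ≋ X′ → Y ≋ Y′ → X ++ Y ≋ X′ ++ Y′
    ++-cong {X} {X′} {Y} {Y′} e e′ = mk≋ λ w →
      trans (coeff-++ X Y w) (trans (+-cong (coeff≈ e w) (coeff≈ e′ w)) (sym (coeff-++ X′ Y′ w)))

    ·-cong : ∀ {k k′ X Y} → k ≈ k′ → X ≋ Y → k · X ≋ k′ · Y
    ·-cong {k} {k′} {X} {Y} k≈k′ e = mk≋ λ w →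
      trans (coeff-· k X w) (trans (*-cong k≈k′ (coeff≈ e w)) (sym (coeff-· k′ Y w)))

    ·-congʳ : ∀ k {X Y} → X ≋ Y → k · X ≋ k · Y
    ·-congʳ k = ·-cong refl

    ·-++ : ∀ k X Y → k · (X ++ Y) ≡ k · X ++ k · Y
    ·-++ k X Y = LP.map-++ _ X Y

    ·-assoc : ∀ k d X → k · d · X ≋ (k * d) · X
    ·-assoc k d X = mk≋ λ w → begin
      coeffOf (k · d · X) w     ≈⟨ coeff-· k (d · X) w ⟩
      k * coeffOf (d · X) w     ≈⟨ *-congˡ (coeff-· d X w) ⟩
      k * (d * coeffOf X w)     ≈⟨ *-assoc k d _ ⟨
      (k * d) * coeffOf X w     ≈⟨ coeff-· (k * d) X w ⟨
      coeffOf ((k * d) · X) w   ∎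
      where open SetoidReasoning setoid

    ·-identity : ∀ X → 1# · X ≋ X
    ·-identity X = mk≋ λ w → trans (coeff-· 1# X w) (*-identityˡ _)

    ∑ : Comb → (B → Carrier) → Carrier
    ∑ []            g = 0#
    ∑ ((k , u) ∷ X) g = k * g u + ∑ X g

    ∑-++ : ∀ X Y g → ∑ (X ++ Y) g ≈ ∑ X g + ∑ Y g
    ∑-++ []            Y g = sym (+-identityˡ _)
    ∑-++ ((k , u) ∷ X) Y g = trans (+-congˡ (∑-++ X Y g)) (sym (+-assoc _ _ _))

    ∑-· : ∀ k X g → ∑ (k · X) g ≈ k * ∑ X g
    ∑-· k []            g = sym (zeroʳ k)
    ∑-· k ((d , u) ∷ X) g = trans (+-cong (*-assoc k d _) (∑-· k X g)) (sym (distribˡ k _ _))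

    ∑-congʳ : ∀ X {g h} → (∀ u → g u ≈ h u) → ∑ X g ≈ ∑ X h
    ∑-congʳ []            g≈h = refl
    ∑-congʳ ((k , u) ∷ X) g≈h = +-cong (*-congˡ (g≈h u)) (∑-congʳ X g≈h)

    ∑-+ : ∀ X g h → ∑ X (λ u → g u + h u) ≈ ∑ X g + ∑ X h
    ∑-+ []            g h = sym (+-identityˡ 0#)
    ∑-+ ((k , u) ∷ X) g h = trans (+-cong (distribˡ k _ _) (∑-+ X g h)) (interchange _ _ _ _)
      where open import Algebra.Properties.CommutativeSemigroup +-commutativeSemigroup using (interchange)

    ∑-* : ∀ X k g → ∑ X (λ u → k * g u) ≈ k * ∑ X g
    ∑-* []            k g = sym (zeroʳ k)
    ∑-* ((d , u) ∷ X) k g = trans (+-cong (x∙yz≈y∙xz d k _) (∑-* X k g)) (sym (distribˡ k _ _))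
      where open import Algebra.Properties.CommutativeSemigroup *-commutativeSemigroup using (x∙yz≈y∙xz)

    -- ∑ X g depends only on the coefficients of X.  The proof removes one
    -- basis element at a time: ∑ Z g = (coefficient of u) · g u + ∑ (Z without u) g.
    remove : B → Comb → Comb
    remove u []            = []
    remove u ((k , v) ∷ Z) with v ≟ u
    ... | yes _ = remove u Z
    ... | no  _ = (k , v) ∷ remove u Z

    remove-here : ∀ k u Z → remove u ((k , u) ∷ Z) ≡ remove u Z
    remove-here k u Z with u ≟ u
    ... | yes _  = ≡.refl
    ... | no u≢u = ⊥-elim (u≢u ≡.refl)

    remove-shorter : ∀ u Z → length (remove u Z) Nat.≤ length Z
    remove-shorter u []            = Nat.z≤n
    remove-shorter u ((k , v) ∷ Z) with v ≟ u
    ... | yes _ = NatP.m≤n⇒m≤1+n (remove-shorter u Z)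
    ... | no  _ = Nat.s≤s (remove-shorter u Z)

    coeff-remove-≡ : ∀ u Z → coeffOf (remove u Z) u ≈ 0#
    coeff-remove-≡ u []            = refl
    coeff-remove-≡ u ((k , v) ∷ Z) with v ≟ u
    ... | yes _   = coeff-remove-≡ u Z
    ... | no  v≢u = trans (coeff-there k v _ v≢u) (coeff-remove-≡ u Z)

    coeff-remove-≢ : ∀ u Z w → u ≢ w → coeffOf (remove u Z) w ≈ coeffOf Z w
    coeff-remove-≢ u []            w u≢w = refl
    coeff-remove-≢ u ((k , v) ∷ Z) w u≢w with v ≟ u
    ... | yes ≡.refl = trans (coeff-remove-≢ u Z w u≢w) (sym (coeff-there k v Z u≢w))
    ... | no  _ with v ≟ w
    ...   | yes _ = +-congˡ (coeff-remove-≢ u Z w u≢w)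
    ...   | no  _ = coeff-remove-≢ u Z w u≢w

    ∑-remove : ∀ g u Z → ∑ Z g ≈ coeffOf Z u * g u + ∑ (remove u Z) g
    ∑-remove g u []            = sym (trans (+-identityʳ _) (zeroˡ _))
    ∑-remove g u ((k , v) ∷ Z) with v ≟ u
    ... | yes ≡.refl = begin
      k * g v + ∑ Z g                                    ≈⟨ +-congˡ (∑-remove g v Z) ⟩
      k * g v + (coeffOf Z v * g v + ∑ (remove v Z) g)   ≈⟨ +-assoc _ _ _ ⟨
      (k * g v + coeffOf Z v * g v) + ∑ (remove v Z) g   ≈⟨ +-congʳ (distribʳ _ _ _) ⟨
      (k + coeffOf Z v) * g v + ∑ (remove v Z) g         ∎
      where open SetoidReasoning setoid
    ... | no _ = begin
      k * g v + ∑ Z g                                    ≈⟨ +-congˡ (∑-remove g u Z) ⟩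
      k * g v + (coeffOf Z u * g u + ∑ (remove u Z) g)   ≈⟨ x∙yz≈y∙xz _ _ _ ⟩
      coeffOf Z u * g u + (k * g v + ∑ (remove u Z) g)   ∎
      where open SetoidReasoning setoid
            open import Algebra.Properties.CommutativeSemigroup +-commutativeSemigroup using (x∙yz≈y∙xz)

    -- a combination with vanishing coefficients pairs to zero with every g
    -- (by induction on a length bound, since remove is not structural)
    ∑-vanishing : ∀ g n Z → length Z Nat.≤ n → Z ≋ [] → ∑ Z g ≈ 0#
    ∑-vanishing g n       []            _             _   = refl
    ∑-vanishing g (suc n) ((k , u) ∷ Z) (Nat.s≤s |Z|≤n) Z≋0 = begin
      ∑ ((k , u) ∷ Z) g                                    ≈⟨ ∑-remove g u ((k , u) ∷ Z) ⟩
      coeffOf ((k , u) ∷ Z) u * g u + ∑ (remove u ((k , u) ∷ Z)) g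
                                                          ≈⟨ +-cong (trans (*-congʳ (coeff≈ Z≋0 u)) (zeroˡ _)) rest ⟩
      0# + 0#                                              ≈⟨ +-identityʳ 0# ⟩
      0#                                                   ∎
      where
      open SetoidReasoning setoid
      rest-vanishes : remove u Z ≋ []
      rest-vanishes = mk≋ λ w → case-on w
        where
        case-on : ∀ w → coeffOf (remove u Z) w ≈ 0#
        case-on w with u ≟ w
        ... | yes ≡.refl = coeff-remove-≡ u Z
        ... | no  u≢w    = trans (coeff-remove-≢ u Z w u≢w) (trans (sym (coeff-there k u Z u≢w)) (coeff≈ Z≋0 w))
      rest : ∑ (remove u ((k , u) ∷ Z)) g ≈ 0#
      rest rewrite remove-here k u Z =
        ∑-vanishing g n (remove u Z) (NatP.≤-trans (remove-shorter u Z) |Z|≤n) rest-vanishes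

    ∑-cong : ∀ {X Y} g → X ≋ Y → ∑ X g ≈ ∑ Y g
    ∑-cong {X} {Y} g X≋Y = begin
      ∑ X g                              ≈⟨ x≈x-y+y ⟩
      (∑ X g - ∑ Y g) + ∑ Y g            ≈⟨ +-congʳ difference-vanishes ⟩
      0# + ∑ Y g                         ≈⟨ +-identityˡ _ ⟩
      ∑ Y g                              ∎
      where
      open SetoidReasoning setoid
      open import Algebra.Properties.Ring ring using (-1*x≈-x)
      x≈x-y+y : ∑ X g ≈ (∑ X g - ∑ Y g) + ∑ Y g
      x≈x-y+y = sym (trans (+-assoc _ _ _) (trans (+-congˡ (-‿inverseˡ _)) (+-identityʳ _)))
      D : Comb
      D = X ++ (- 1#) · Y
      D≋0 : D ≋ []
      D≋0 = mk≋ λ w → trans (coeff-++ X _ w)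
        (trans (+-congˡ (trans (coeff-· _ Y w) (-1*x≈-x _))) (trans (+-congʳ (coeff≈ X≋Y w)) (-‿inverseʳ _)))
      difference-vanishes : ∑ X g - ∑ Y g ≈ 0#
      difference-vanishes = begin
        ∑ X g - ∑ Y g               ≈⟨ +-congˡ (trans (sym (-1*x≈-x _)) (sym (∑-· _ Y g))) ⟩
        ∑ X g + ∑ ((- 1#) · Y) g    ≈⟨ ∑-++ X _ g ⟨
        ∑ D g                       ≈⟨ ∑-vanishing g (length D) D NatP.≤-refl D≋0 ⟩
        0#                          ∎

    -- Formal linear expressions over combinations: an identity between two of
    -- them holds as soon as it holds coefficientwise, which reduces it to a
    -- ring identity in the coefficients (checked by the ring solver).
    infixl 6 _⊞_
    infixr 7 _⊠_
    data LinExpr : Set (c ⊔ b) where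
      atom : Comb → LinExpr
      _⊞_  : LinExpr → LinExpr → LinExpr
      _⊠_  : Carrier → LinExpr → LinExpr

    ⟦_⟧E : LinExpr → Comb
    ⟦ atom X ⟧E = X
    ⟦ e ⊞ e′ ⟧E = ⟦ e ⟧E ++ ⟦ e′ ⟧E
    ⟦ k ⊠ e ⟧E  = k · ⟦ e ⟧E

    coeffE : LinExpr → B → Carrier
    coeffE (atom X) w = coeffOf X w
    coeffE (e ⊞ e′) w = coeffE e w + coeffE e′ w
    coeffE (k ⊠ e)  w = k * coeffE e w

    coeff-⟦⟧E : ∀ e w → coeffOf ⟦ e ⟧E w ≈ coeffE e w
    coeff-⟦⟧E (atom X) w = refl
    coeff-⟦⟧E (e ⊞ e′) w = trans (coeff-++ ⟦ e ⟧E ⟦ e′ ⟧E w) (+-cong (coeff-⟦⟧E e w) (coeff-⟦⟧E e′ w))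
    coeff-⟦⟧E (k ⊠ e)  w = trans (coeff-· k ⟦ e ⟧E w) (*-congˡ (coeff-⟦⟧E e w))

    ≋-coefficientwise : ∀ e e′ → (∀ w → coeffE e w ≈ coeffE e′ w) → ⟦ e ⟧E ≋ ⟦ e′ ⟧E
    ≋-coefficientwise e e′ e≈e′ = mk≋ λ w → trans (coeff-⟦⟧E e w) (trans (e≈e′ w) (sym (coeff-⟦⟧E e′ w)))

  module Maps {b₁ b₂} {B₁ : Set b₁} {B₂ : Set b₂}
              (_≟₁_ : DecidableEquality B₁) (_≟₂_ : DecidableEquality B₂) where
    private
      module C₁ = Combinations _≟₁_
      module C₂ = Combinations _≟₂_
    open C₂ using (_≋_; mk≋; coeff≈; _·_; ≋-refl; ≋-sym; ≋-trans; ≋-reflexive; ++-cong; ·-congʳ)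

    extend : (B₁ → C₂.Comb) → C₁.Comb → C₂.Comb
    extend f []            = []
    extend f ((k , u) ∷ X) = k · f u ++ extend f X

    coeff-extend : ∀ f X w → C₂.coeffOf (extend f X) w ≈ C₁.∑ X (λ u → C₂.coeffOf (f u) w)
    coeff-extend f []            w = refl
    coeff-extend f ((k , u) ∷ X) w =
      trans (C₂.coeff-++ (k · f u) _ w) (+-cong (C₂.coeff-· k (f u) w) (coeff-extend f X w))

    extend-cong : ∀ f {X Y} → X C₁.≋ Y → extend f X ≋ extend f Y
    extend-cong f {X} {Y} X≋Y = mk≋ λ w →
      trans (coeff-extend f X w) (trans (C₁.∑-cong _ X≋Y) (sym (coeff-extend f Y w)))

    extend-congf : ∀ {f g} → (∀ u → f u ≋ g u) → ∀ X → extend f X ≋ extend g X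
    extend-congf f≋g []            = ≋-refl
    extend-congf f≋g ((k , u) ∷ X) = ++-cong (·-congʳ k (f≋g u)) (extend-congf f≋g X)

    extend-++ : ∀ f X Y → extend f (X ++ Y) ≡ extend f X ++ extend f Y
    extend-++ f []            Y = ≡.refl
    extend-++ f ((k , u) ∷ X) Y =
      ≡.trans (≡.cong (k · f u ++_) (extend-++ f X Y)) (≡.sym (LP.++-assoc (k · f u) _ _))

    extend-· : ∀ f k X → extend f (k C₁.· X) ≋ k · extend f X
    extend-· f k []            = ≋-refl
    extend-· f k ((d , u) ∷ X) = ≋-trans (++-cong (≋-sym (C₂.·-assoc k d (f u))) (extend-· f k X))
                                         (≋-reflexive (≡.sym (C₂.·-++ k (d · f u) (extend f X))))

    extend-basis : ∀ f u → extend f C₁.[ u ] ≋ f u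
    extend-basis f u = ≋-trans (≋-reflexive (LP.++-identityʳ _)) (C₂.·-identity (f u))

    extend-zero : ∀ X → extend (λ _ → []) X ≡ []
    extend-zero []            = ≡.refl
    extend-zero ((k , u) ∷ X) = extend-zero X

    extend-+ : ∀ f g X → extend f X ++ extend g X ≋ extend (λ u → f u ++ g u) X
    extend-+ f g X = mk≋ λ w → begin
      C₂.coeffOf (extend f X ++ extend g X) w
        ≈⟨ C₂.coeff-++ (extend f X) _ w ⟩
      C₂.coeffOf (extend f X) w + C₂.coeffOf (extend g X) w
        ≈⟨ +-cong (coeff-extend f X w) (coeff-extend g X w) ⟩
      C₁.∑ X (λ u → C₂.coeffOf (f u) w) + C₁.∑ X (λ u → C₂.coeffOf (g u) w)
        ≈⟨ C₁.∑-+ X _ _ ⟨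
      C₁.∑ X (λ u → C₂.coeffOf (f u) w + C₂.coeffOf (g u) w)
        ≈⟨ C₁.∑-congʳ X (λ u → C₂.coeff-++ (f u) (g u) w) ⟨
      C₁.∑ X (λ u → C₂.coeffOf (f u ++ g u) w)
        ≈⟨ coeff-extend _ X w ⟨
      C₂.coeffOf (extend (λ u → f u ++ g u) X) w ∎
      where open SetoidReasoning setoid

    extend-·ˡ : ∀ f k X → k · extend f X ≋ extend (λ u → k · f u) X
    extend-·ˡ f k X = mk≋ λ w → begin
      C₂.coeffOf (k · extend f X) w                 ≈⟨ C₂.coeff-· k (extend f X) w ⟩
      k * C₂.coeffOf (extend f X) w                 ≈⟨ *-congˡ (coeff-extend f X w) ⟩
      k * C₁.∑ X (λ u → C₂.coeffOf (f u) w)         ≈⟨ C₁.∑-* X k _ ⟨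
      C₁.∑ X (λ u → k * C₂.coeffOf (f u) w)         ≈⟨ C₁.∑-congʳ X (λ u → C₂.coeff-· k (f u) w) ⟨
      C₁.∑ X (λ u → C₂.coeffOf (k · f u) w)         ≈⟨ coeff-extend _ X w ⟨
      C₂.coeffOf (extend (λ u → k · f u) X) w       ∎
      where open SetoidReasoning setoid

    -- F is linear: it agrees with the linear extension of its values on the basis.
    -- (This packages additivity, homogeneity and compatibility with ≋ at once.)
    Linear : (C₁.Comb → C₂.Comb) → Set (c ⊔ b₁ ⊔ b₂ ⊔ ℓ)
    Linear F = ∀ X → F X ≋ extend (λ u → F C₁.[ u ]) X

    extend-linear : ∀ f → Linear (extend f)
    extend-linear f = extend-congf (λ u → ≋-sym (extend-basis f u))

    module Linear {F : C₁.Comb → C₂.Comb} (F-lin : Linear F) where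
      cong : ∀ {X Y} → X C₁.≋ Y → F X ≋ F Y
      cong {X} {Y} X≋Y = ≋-trans (F-lin X) (≋-trans (extend-cong _ X≋Y) (≋-sym (F-lin Y)))

      ++-homo : ∀ X Y → F (X ++ Y) ≋ F X ++ F Y
      ++-homo X Y = ≋-trans (F-lin (X ++ Y))
        (≋-trans (≋-reflexive (extend-++ _ X Y)) (++-cong (≋-sym (F-lin X)) (≋-sym (F-lin Y))))

      ·-homo : ∀ k X → F (k C₁.· X) ≋ k · F X
      ·-homo k X = ≋-trans (F-lin (k C₁.· X)) (≋-trans (extend-· _ k X) (·-congʳ k (≋-sym (F-lin X))))

      zero-homo : F [] ≋ []
      zero-homo = F-lin []

      ++·-homo : ∀ X k Y → F (X ++ k C₁.· Y) ≋ F X ++ k · F Y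
      ++·-homo X k Y = ≋-trans (++-homo X (k C₁.· Y)) (++-cong ≋-refl (·-homo k Y))

    linear-ext : ∀ {F G} → Linear F → Linear G → (∀ u → F C₁.[ u ] ≋ G C₁.[ u ]) → ∀ X → F X ≋ G X
    linear-ext F-lin G-lin F≋G X = ≋-trans (F-lin X) (≋-trans (extend-congf F≋G X) (≋-sym (G-lin X)))

    linear-≋ : ∀ {F G} → Linear F → (∀ X → F X ≋ G X) → Linear G
    linear-≋ F-lin F≋G X = ≋-trans (≋-sym (F≋G X)) (≋-trans (F-lin X) (extend-congf (λ u → F≋G C₁.[ u ]) X))

    linear-++ : ∀ {F G} → Linear F → Linear G → Linear (λ X → F X ++ G X)
    linear-++ F-lin G-lin X = ≋-trans (++-cong (F-lin X) (G-lin X)) (extend-+ _ _ X)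

    linear-· : ∀ {F} k → Linear F → Linear (λ X → k · F X)
    linear-· k F-lin X = ≋-trans (·-congʳ k (F-lin X)) (extend-·ˡ _ k X)

    linear-zero : Linear (λ X → [])
    linear-zero X = ≋-sym (≋-reflexive (extend-zero X))

  module Identity {b} {B : Set b} (_≟_ : DecidableEquality B) where
    open Combinations _≟_
    open Maps _≟_ _≟_

    extend-basis-map : ∀ X → extend [_] X ≋ X
    extend-basis-map []            = ≋-refl
    extend-basis-map ((k , u) ∷ X) = ∷-cong (*-identityʳ k) (extend-basis-map X)

    linear-id : Linear (λ X → X)
    linear-id X = ≋-sym (extend-basis-map X)

  module Composition {b₀ b₁ b₂} {B₀ : Set b₀} {B₁ : Set b₁} {B₂ : Set b₂}
                     (_≟₀_ : DecidableEquality B₀) (_≟₁_ : DecidableEquality B₁)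
                     (_≟₂_ : DecidableEquality B₂) where
    private
      module C₁ = Combinations _≟₁_
      module C₂ = Combinations _≟₂_
      module M₀₁ = Maps _≟₀_ _≟₁_
      module M₁₂ = Maps _≟₁_ _≟₂_
      module M₀₂ = Maps _≟₀_ _≟₂_
    open C₂ using (≋-refl; ≋-sym; ≋-trans; ≋-reflexive; ++-cong)

    extend-∘ : ∀ g f X → M₁₂.extend g (M₀₁.extend f X) C₂.≋ M₀₂.extend (λ u → M₁₂.extend g (f u)) X
    extend-∘ g f []            = ≋-refl
    extend-∘ g f ((k , u) ∷ X) =
      ≋-trans (≋-reflexive (M₁₂.extend-++ g (k C₁.· f u) _))
              (++-cong (M₁₂.extend-· g k (f u)) (extend-∘ g f X))

    linear-∘ : ∀ {F G} → M₀₁.Linear F → M₁₂.Linear G → M₀₂.Linear (λ X → G (F X))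
    linear-∘ {F} {G} F-lin G-lin X = ≋-trans (M₁₂.Linear.cong G-lin (F-lin X))
      (≋-trans (G-lin _) (≋-trans (extend-∘ _ _ X)
        (M₀₂.extend-congf (λ u → ≋-sym (G-lin (F (Combinations.[_] _≟₀_ u)))) X)))

    linear-family : ∀ (h : B₀ → C₁.Comb → C₂.Comb) → (∀ x → M₁₂.Linear (h x)) →
                    ∀ ξ → M₁₂.Linear (λ X → M₀₂.extend (λ x → h x X) ξ)
    linear-family h h-lin []            = M₁₂.linear-zero
    linear-family h h-lin ((k , x) ∷ ξ) = M₁₂.linear-++ (M₁₂.linear-· k (h-lin x)) (linear-family h h-lin ξ)

module Setting {c ℓ a : Level} (F : Field c ℓ) (A : Set a)
               (ι : A → ℕ) (ι-inj : Injective _≡_ _≡_ ι)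
               (_◇_ : A → A → List (Field.Carrier F × A)) where
  open Field F
  open Interp F A ι ι-inj _◇_
  open FormalCombinations commutativeRing
  open IntegerCoefficients commutativeRing using (Polynomial; solve; _:=_; _:+_; _:*_; _:-_; :-_; 0ₚ; 1ₚ)

  module Wd = Combinations _≟W_
  module L = Combinations _≟A_
  open Wd using (_≋_; mk≋; coeff≈; ≋-refl; ≋-sym; ≋-trans; ≋-reflexive; _·_; ++-cong; ·-congʳ; [_];
                atom; _⊞_; _⊠_; ⟦_⟧E)

  module WW  = Maps _≟W_ _≟W_
  module AW  = Maps _≟A_ _≟W_
  module AA  = Maps _≟A_ _≟A_
  module WWW = Composition _≟W_ _≟W_ _≟W_
  module AWW = Composition _≟A_ _≟W_ _≟W_
  module AAW = Composition _≟A_ _≟A_ _≟W_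
  module AAA = Composition _≟A_ _≟A_ _≟A_

  coeff≡coeffOf : ∀ X w → coeff X w ≡ Wd.coeffOf X w
  coeff≡coeffOf []            w = ≡.refl
  coeff≡coeffOf ((k , u) ∷ X) w with u ≟W w
  ... | yes _ = ≡.cong (k +_) (coeff≡coeffOf X w)
  ... | no  _ = coeff≡coeffOf X w

  coeffA≡coeffOf : ∀ ξ x → coeffA ξ x ≡ L.coeffOf ξ x
  coeffA≡coeffOf []            x = ≡.refl
  coeffA≡coeffOf ((k , y) ∷ ξ) x with y ≟A x
  ... | yes _ = ≡.cong (k +_) (coeffA≡coeffOf ξ x)
  ... | no  _ = coeffA≡coeffOf ξ x

  ≈L⇒≋ : ∀ {X Y} → X ≈L Y → X ≋ Y
  ≈L⇒≋ {X} {Y} X≈Y = mk≋ λ w → ≡.subst₂ _≈_ (coeff≡coeffOf X w) (coeff≡coeffOf Y w) (X≈Y w)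

  ≋⇒≈L : ∀ {X Y} → X ≋ Y → X ≈L Y
  ≋⇒≈L {X} {Y} X≋Y w = ≡.subst₂ _≈_ (≡.sym (coeff≡coeffOf X w)) (≡.sym (coeff≡coeffOf Y w)) (coeff≈ X≋Y w)

  ≈A⇒≋ : ∀ {ξ η} → ξ ≈A η → ξ L.≋ η
  ≈A⇒≋ {ξ} {η} ξ≈η = L.mk≋ λ x → ≡.subst₂ _≈_ (coeffA≡coeffOf ξ x) (coeffA≡coeffOf η x) (ξ≈η x)

  scale≡· : ∀ k X → scale k X ≡ k · X
  scale≡· k X = LP.map-cong (λ _ → ≡.refl) X

  linExt≡extend : ∀ f X → linExt f X ≡ WW.extend f X
  linExt≡extend f []            = ≡.refl
  linExt≡extend f ((k , u) ∷ X) = ≡.cong₂ _++_ (scale≡· k (f u)) (linExt≡extend f X)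

  prependA≡extend : ∀ ξ X → prependA ξ X ≡ AW.extend (λ x → prepend x X) ξ
  prependA≡extend []            X = ≡.refl
  prependA≡extend ((k , x) ∷ ξ) X = ≡.cong₂ _++_ (scale≡· k (prepend x X)) (prependA≡extend ξ X)

  diaAL≡extend : ∀ ξ X → diaAL ξ X ≡ AW.extend (λ x → WW.extend (letterDiaWord x) X) ξ
  diaAL≡extend []            X = ≡.refl
  diaAL≡extend ((k , x) ∷ ξ) X =
    ≡.cong₂ _++_ (≡.trans (scale≡· k _) (≡.cong (k ·_) (linExt≡extend _ X))) (diaAL≡extend ξ X)

  ⋆≋extend : ∀ p q → p ⋆ q ≋ WW.extend (λ u → WW.extend (qsh u) q) p
  ⋆≋extend []            q = ≋-refl
  ⋆≋extend ((k , u) ∷ p) q = ++-cong (inner q) (⋆≋extend p q)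
    where
    inner : ∀ q → concatMap (λ (d , v) → scale (k * d) (qsh u v)) q ≋ k · WW.extend (qsh u) q
    inner []            = ≋-refl
    inner ((d , v) ∷ q) = ≋-trans
      (++-cong (≋-trans (≋-reflexive (scale≡· (k * d) (qsh u v))) (≋-sym (Wd.·-assoc k d _))) (inner q))
      (≋-reflexive (≡.sym (Wd.·-++ k (d · qsh u v) _)))

  diaA≋extend : ∀ p q → diaA p q L.≋ AA.extend (λ x → AA.extend (x ◇_) q) p
  diaA≋extend []            q = L.≋-refl
  diaA≋extend ((k , x) ∷ p) q = L.++-cong (inner q) (diaA≋extend p q)
    where
    inner : ∀ q → concatMap (λ (d , y) → map (λ (e , z) → (k * d * e , z)) (x ◇ y)) q
                  L.≋ k L.· AA.extend (x ◇_) q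
    inner []            = L.≋-refl
    inner ((d , y) ∷ q) = L.≋-trans
      (L.++-cong (L.≋-trans (L.≋-reflexive (LP.map-cong (λ _ → ≡.refl) (x ◇ y))) (L.≋-sym (L.·-assoc k d _))) (inner q))
      (L.≋-reflexive (≡.sym (L.·-++ k (d L.· (x ◇ y)) _)))

  prepend-linear : ∀ x → WW.Linear (prepend x)
  prepend-linear x = WW.linear-≋ (WW.extend-linear (λ u → [ x ∷ u ])) extend≋prepend
    where
    extend≋prepend : ∀ X → WW.extend (λ u → [ x ∷ u ]) X ≋ prepend x X
    extend≋prepend []            = ≋-refl
    extend≋prepend ((k , u) ∷ X) = Wd.∷-cong (*-identityʳ k) (extend≋prepend X)

  prependA-linearʳ : ∀ ξ → WW.Linear (prependA ξ)
  prependA-linearʳ ξ = WW.linear-≋ (AWW.linear-family prepend prepend-linear ξ)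
                                   (λ X → ≋-reflexive (≡.sym (prependA≡extend ξ X)))

  prependA-linearˡ : ∀ X → AW.Linear (λ ξ → prependA ξ X)
  prependA-linearˡ X = AW.linear-≋ (AW.extend-linear (λ x → prepend x X))
                                   (λ ξ → ≋-reflexive (≡.sym (prependA≡extend ξ X)))

  diaAL-linearʳ : ∀ ξ → WW.Linear (diaAL ξ)
  diaAL-linearʳ ξ = WW.linear-≋
    (AWW.linear-family (λ x → WW.extend (letterDiaWord x)) (λ x → WW.extend-linear (letterDiaWord x)) ξ)
    (λ X → ≋-reflexive (≡.sym (diaAL≡extend ξ X)))

  diaAL-linearˡ : ∀ X → AW.Linear (λ ξ → diaAL ξ X)
  diaAL-linearˡ X = AW.linear-≋ (AW.extend-linear (λ x → WW.extend (letterDiaWord x) X))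
                                (λ ξ → ≋-reflexive (≡.sym (diaAL≡extend ξ X)))

  ⋆-linearˡ : ∀ q → WW.Linear (_⋆ q)
  ⋆-linearˡ q = WW.linear-≋ (WW.extend-linear (λ u → WW.extend (qsh u) q)) (λ p → ≋-sym (⋆≋extend p q))

  ⋆-linearʳ : ∀ p → WW.Linear (p ⋆_)
  ⋆-linearʳ p = WW.linear-≋ (WWW.linear-family (λ u → WW.extend (qsh u)) (λ u → WW.extend-linear (qsh u)) p)
                            (λ q → ≋-sym (⋆≋extend p q))

  Σ^-linear : ∀ s → WW.Linear (Σ^ s)
  Σ^-linear s = WW.linear-≋ (WW.extend-linear (Σw s)) (λ X → ≋-reflexive (≡.sym (linExt≡extend (Σw s) X)))

  diaA-linearˡ : ∀ q → AA.Linear (λ p → diaA p q)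
  diaA-linearˡ q = AA.linear-≋ (AA.extend-linear (λ x → AA.extend (x ◇_) q)) (λ p → L.≋-sym (diaA≋extend p q))

  diaA-linearʳ : ∀ p → AA.Linear (diaA p)
  diaA-linearʳ p = AA.linear-≋ (AAA.linear-family (λ x → AA.extend (x ◇_)) (λ x → AA.extend-linear (x ◇_)) p)
                               (λ q → L.≋-sym (diaA≋extend p q))

  prepend-cong : ∀ x {X Y} → X ≋ Y → prepend x X ≋ prepend x Y
  prepend-cong x = WW.Linear.cong (prepend-linear x)

  prependA-congʳ : ∀ ξ {X Y} → X ≋ Y → prependA ξ X ≋ prependA ξ Y
  prependA-congʳ ξ = WW.Linear.cong (prependA-linearʳ ξ)

  prependA-congˡ : ∀ {ξ η} X → ξ L.≋ η → prependA ξ X ≋ prependA η X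
  prependA-congˡ X = AW.Linear.cong (prependA-linearˡ X)

  diaAL-congʳ : ∀ ξ {X Y} → X ≋ Y → diaAL ξ X ≋ diaAL ξ Y
  diaAL-congʳ ξ = WW.Linear.cong (diaAL-linearʳ ξ)

  diaAL-congˡ : ∀ {ξ η} X → ξ L.≋ η → diaAL ξ X ≋ diaAL η X
  diaAL-congˡ X = AW.Linear.cong (diaAL-linearˡ X)

  ⋆-cong : ∀ {X X′ Y Y′} → X ≋ X′ → Y ≋ Y′ → X ⋆ Y ≋ X′ ⋆ Y′
  ⋆-cong {X} {X′} {Y} {Y′} X≋X′ Y≋Y′ =
    ≋-trans (WW.Linear.cong (⋆-linearˡ Y) X≋X′) (WW.Linear.cong (⋆-linearʳ X′) Y≋Y′)

  ⋆-congˡ : ∀ {X X′} Y → X ≋ X′ → X ⋆ Y ≋ X′ ⋆ Y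
  ⋆-congˡ Y = WW.Linear.cong (⋆-linearˡ Y)

  ⋆-congʳ : ∀ X {Y Y′} → Y ≋ Y′ → X ⋆ Y ≋ X ⋆ Y′
  ⋆-congʳ X = WW.Linear.cong (⋆-linearʳ X)

  Σ^-cong : ∀ s {X Y} → X ≋ Y → Σ^ s X ≋ Σ^ s Y
  Σ^-cong s = WW.Linear.cong (Σ^-linear s)

  scale-cong : ∀ k {X Y} → X ≋ Y → scale k X ≋ scale k Y
  scale-cong k {X} {Y} X≋Y =
    ≋-trans (≋-reflexive (scale≡· k X)) (≋-trans (·-congʳ k X≋Y) (≋-reflexive (≡.sym (scale≡· k Y))))

  prepend≋prependA : ∀ x X → prepend x X ≋ prependA L.[ x ] X
  prepend≋prependA x X =
    ≋-sym (≋-trans (≋-reflexive (≡.trans (LP.++-identityʳ _) (scale≡· 1# _))) (Wd.·-identity _))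

  ⋆-basis : ∀ u v → [ u ] ⋆ [ v ] ≋ qsh u v
  ⋆-basis u v = ≋-trans (⋆≋extend [ u ] [ v ])
    (≋-trans (WW.extend-basis (λ u → WW.extend (qsh u) [ v ]) u) (WW.extend-basis (qsh u) v))

  diaA-basis : ∀ x y → diaA L.[ x ] L.[ y ] L.≋ (x ◇ y)
  diaA-basis x y = L.≋-trans (diaA≋extend L.[ x ] L.[ y ])
    (L.≋-trans (AA.extend-basis (λ x → AA.extend (x ◇_) L.[ y ]) x) (AA.extend-basis (x ◇_) y))

  diaAL-basis : ∀ x Z → diaAL L.[ x ] Z ≋ WW.extend (letterDiaWord x) Z
  diaAL-basis x Z = ≋-trans (≋-reflexive (diaAL≡extend L.[ x ] Z))
                            (AW.extend-basis (λ x → WW.extend (letterDiaWord x) Z) x)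

  Σ^-basis : ∀ s u → Σ^ s [ u ] ≋ Σw s u
  Σ^-basis s u = ≋-trans (≋-reflexive (linExt≡extend (Σw s) [ u ])) (WW.extend-basis (Σw s) u)

  infixl 7 _◆_
  _◆_ : LinA → LinA → LinA
  _◆_ = diaA

  ◆-congˡ : ∀ {p p′} q → p L.≋ p′ → p ◆ q L.≋ p′ ◆ q
  ◆-congˡ q = AA.Linear.cong (diaA-linearˡ q)

  ◆-congʳ : ∀ p {q q′} → q L.≋ q′ → p ◆ q L.≋ p ◆ q′
  ◆-congʳ p = AA.Linear.cong (diaA-linearʳ p)

  diaAL-prependA : ∀ ξ η X → diaAL ξ (prependA η X) ≋ prependA (ξ ◆ η) X
  diaAL-prependA ξ η X =
    AW.linear-ext (diaAL-linearˡ (prependA η X)) (AAW.linear-∘ (diaA-linearˡ η) (prependA-linearˡ X))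
      (λ x → AW.linear-ext (AWW.linear-∘ (prependA-linearˡ X) (diaAL-linearʳ L.[ x ]))
                           (AAW.linear-∘ (diaA-linearʳ L.[ x ]) (prependA-linearˡ X))
                           (on-letters x) η) ξ
    where
    open Wd.≋-Reasoning
    on-letters : ∀ x y → diaAL L.[ x ] (prependA L.[ y ] X) ≋ prependA (L.[ x ] ◆ L.[ y ]) X
    on-letters x y = begin
      diaAL L.[ x ] (prependA L.[ y ] X)
        ≈⟨ diaAL-basis x (prependA L.[ y ] X) ⟩
      WW.extend (letterDiaWord x) (prependA L.[ y ] X)
        ≈⟨ WW.extend-cong (letterDiaWord x) (prepend≋prependA y X) ⟨
      WW.extend (letterDiaWord x) (prepend y X)
        ≡⟨ extend-prepend X ⟩
      WW.extend (λ u → prependA (x ◇ y) [ u ]) X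
        ≈⟨ prependA-linearʳ (x ◇ y) X ⟨
      prependA (x ◇ y) X
        ≈⟨ prependA-congˡ X (diaA-basis x y) ⟨
      prependA (L.[ x ] ◆ L.[ y ]) X ∎
      where
      extend-prepend : ∀ X → WW.extend (letterDiaWord x) (prepend y X)
                             ≡ WW.extend (λ u → prependA (x ◇ y) [ u ]) X
      extend-prepend []            = ≡.refl
      extend-prepend ((k , u) ∷ X) = ≡.cong (k · prependA (x ◇ y) [ u ] ++_) (extend-prepend X)

  diaAL-unit : ∀ ξ → diaAL ξ [ [] ] ≋ []
  diaAL-unit ξ = ≋-trans (≋-reflexive (diaAL≡extend ξ [ [] ])) (≋-reflexive (AW.extend-zero ξ))

  ⋆-identityˡ : ∀ Y → [ [] ] ⋆ Y ≋ Y
  ⋆-identityˡ Y = ≋-trans (⋆≋extend [ [] ] Y)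
    (≋-trans (WW.extend-basis (λ u → WW.extend (qsh u) Y) []) (Identity.extend-basis-map _≟W_ Y))

  ⋆-identityʳ : ∀ X → X ⋆ [ [] ] ≋ X
  ⋆-identityʳ X = ≋-trans (⋆≋extend X [ [] ])
    (≋-trans (WW.extend-congf (λ u → ≋-trans (WW.extend-basis (qsh u) []) (≋-reflexive (qsh-[] u))) X)
             (Identity.extend-basis-map _≟W_ X))
    where
    qsh-[] : ∀ u → qsh u [] ≡ [ u ]
    qsh-[] []      = ≡.refl
    qsh-[] (x ∷ u) = ≡.refl

  -- Both sides of the quasi-shuffle recursion for combinations ξ X, η Y whose
  -- first letters are arbitrary ξ, η ∈ kA; each side is linear in each of ξ, η, X, Y.
  module PrefixedRecursion where
    lhs rhs : LinA → LinA → Lin → Lin → Lin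
    lhs ξ η X Y = prependA ξ X ⋆ prependA η Y
    rhs ξ η X Y = prependA ξ (X ⋆ prependA η Y) ++ prependA η (prependA ξ X ⋆ Y) ++ prependA (ξ ◆ η) (X ⋆ Y)

    lhs-ξ : ∀ η X Y → AW.Linear (λ ξ → lhs ξ η X Y)
    lhs-ξ η X Y = AWW.linear-∘ (prependA-linearˡ X) (⋆-linearˡ (prependA η Y))

    rhs-ξ : ∀ η X Y → AW.Linear (λ ξ → rhs ξ η X Y)
    rhs-ξ η X Y = AW.linear-++ (prependA-linearˡ (X ⋆ prependA η Y))
      (AW.linear-++ (AWW.linear-∘ (AWW.linear-∘ (prependA-linearˡ X) (⋆-linearˡ Y)) (prependA-linearʳ η))
                    (AAW.linear-∘ (diaA-linearˡ η) (prependA-linearˡ (X ⋆ Y))))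

    lhs-η : ∀ ξ X Y → AW.Linear (λ η → lhs ξ η X Y)
    lhs-η ξ X Y = AWW.linear-∘ (prependA-linearˡ Y) (⋆-linearʳ (prependA ξ X))

    rhs-η : ∀ ξ X Y → AW.Linear (λ η → rhs ξ η X Y)
    rhs-η ξ X Y = AW.linear-++ (AWW.linear-∘ (AWW.linear-∘ (prependA-linearˡ Y) (⋆-linearʳ X)) (prependA-linearʳ ξ))
      (AW.linear-++ (prependA-linearˡ (prependA ξ X ⋆ Y)) (AAW.linear-∘ (diaA-linearʳ ξ) (prependA-linearˡ (X ⋆ Y))))

    lhs-X : ∀ ξ η Y → WW.Linear (λ X → lhs ξ η X Y)
    lhs-X ξ η Y = WWW.linear-∘ (prependA-linearʳ ξ) (⋆-linearˡ (prependA η Y))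

    rhs-X : ∀ ξ η Y → WW.Linear (λ X → rhs ξ η X Y)
    rhs-X ξ η Y = WW.linear-++ (WWW.linear-∘ (⋆-linearˡ (prependA η Y)) (prependA-linearʳ ξ))
      (WW.linear-++ (WWW.linear-∘ (WWW.linear-∘ (prependA-linearʳ ξ) (⋆-linearˡ Y)) (prependA-linearʳ η))
                    (WWW.linear-∘ (⋆-linearˡ Y) (prependA-linearʳ (ξ ◆ η))))

    lhs-Y : ∀ ξ η X → WW.Linear (λ Y → lhs ξ η X Y)
    lhs-Y ξ η X = WWW.linear-∘ (prependA-linearʳ η) (⋆-linearʳ (prependA ξ X))

    rhs-Y : ∀ ξ η X → WW.Linear (λ Y → rhs ξ η X Y)
    rhs-Y ξ η X = WW.linear-++ (WWW.linear-∘ (WWW.linear-∘ (prependA-linearʳ η) (⋆-linearʳ X)) (prependA-linearʳ ξ))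
      (WW.linear-++ (WWW.linear-∘ (⋆-linearʳ (prependA ξ X)) (prependA-linearʳ η))
                    (WWW.linear-∘ (⋆-linearʳ X) (prependA-linearʳ (ξ ◆ η))))

    -- on letters and words the recursion is the definition of qsh
    on-words : ∀ x y u v → lhs L.[ x ] L.[ y ] [ u ] [ v ] ≋ rhs L.[ x ] L.[ y ] [ u ] [ v ]
    on-words x y u v = begin
      prependA L.[ x ] [ u ] ⋆ prependA L.[ y ] [ v ]
        ≈⟨ ⋆-cong (≋-sym (prepend≋prependA x [ u ])) (≋-sym (prepend≋prependA y [ v ])) ⟩
      [ x ∷ u ] ⋆ [ y ∷ v ]
        ≈⟨ ⋆-basis (x ∷ u) (y ∷ v) ⟩
      prepend x (qsh u (y ∷ v)) ++ prepend y (qsh (x ∷ u) v) ++ prependA (x ◇ y) (qsh u v)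
        ≈⟨ ++-cong first (++-cong second third) ⟩
      rhs L.[ x ] L.[ y ] [ u ] [ v ] ∎
      where
      open Wd.≋-Reasoning
      first : prepend x (qsh u (y ∷ v)) ≋ prependA L.[ x ] ([ u ] ⋆ prependA L.[ y ] [ v ])
      first = ≋-trans (prepend-cong x (≋-sym (≋-trans (⋆-congʳ [ u ] (≋-sym (prepend≋prependA y [ v ])))
                                                       (⋆-basis u (y ∷ v)))))
                      (prepend≋prependA x _)
      second : prepend y (qsh (x ∷ u) v) ≋ prependA L.[ y ] (prependA L.[ x ] [ u ] ⋆ [ v ])
      second = ≋-trans (prepend-cong y (≋-sym (≋-trans (⋆-congˡ [ v ] (≋-sym (prepend≋prependA x [ u ])))
                                                        (⋆-basis (x ∷ u) v))))
                       (prepend≋prependA y _)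
      third : prependA (x ◇ y) (qsh u v) ≋ prependA (L.[ x ] ◆ L.[ y ]) ([ u ] ⋆ [ v ])
      third = ≋-trans (prependA-congʳ (x ◇ y) (≋-sym (⋆-basis u v)))
                      (prependA-congˡ ([ u ] ⋆ [ v ]) (L.≋-sym (diaA-basis x y)))

  -- The quasi-shuffle recursion for first letters ξ, η ∈ kA: reduce by
  -- linearity in ξ, η, X, Y to letters and words.
  ⋆-prependA : ∀ ξ η X Y →
    prependA ξ X ⋆ prependA η Y
      ≋ prependA ξ (X ⋆ prependA η Y) ++ prependA η (prependA ξ X ⋆ Y) ++ prependA (ξ ◆ η) (X ⋆ Y)
  ⋆-prependA ξ η X Y =
    AW.linear-ext (lhs-ξ η X Y) (rhs-ξ η X Y) (λ x →
      AW.linear-ext (lhs-η L.[ x ] X Y) (rhs-η L.[ x ] X Y) (λ y →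
        WW.linear-ext (lhs-X L.[ x ] L.[ y ] Y) (rhs-X L.[ x ] L.[ y ] Y) (λ u →
          WW.linear-ext (lhs-Y L.[ x ] L.[ y ] [ u ]) (rhs-Y L.[ x ] L.[ y ] [ u ])
                        (on-words x y u) Y) X) η) ξ
    where open PrefixedRecursion

  -- ξ ◇ (γ X ⋆ η Y), from the recursion and ξ ◇ (η X) = (ξ ◆ η) X; the new
  -- first letters p, q, t may be any elements equal to ξ ◆ γ, ξ ◆ η, ξ ◆ (γ ◆ η).
  diaAL-⋆-prependA : ∀ ξ γ η X Y {p q t} → ξ ◆ γ L.≋ p → ξ ◆ η L.≋ q → ξ ◆ (γ ◆ η) L.≋ t →
    diaAL ξ (prependA γ X ⋆ prependA η Y)
      ≋ prependA p (X ⋆ prependA η Y) ++ prependA q (prependA γ X ⋆ Y) ++ prependA t (X ⋆ Y)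
  diaAL-⋆-prependA ξ γ η X Y {p} {q} {t} ξγ≋p ξη≋q ξγη≋t = begin
    diaAL ξ (prependA γ X ⋆ prependA η Y)
      ≈⟨ diaAL-congʳ ξ (⋆-prependA γ η X Y) ⟩
    diaAL ξ (prependA γ P ++ prependA η Q ++ prependA (γ ◆ η) (X ⋆ Y))
      ≈⟨ WW.Linear.++-homo D (prependA γ P) _ ⟩
    diaAL ξ (prependA γ P) ++ diaAL ξ (prependA η Q ++ prependA (γ ◆ η) (X ⋆ Y))
      ≈⟨ ++-cong ≋-refl (WW.Linear.++-homo D (prependA η Q) _) ⟩
    diaAL ξ (prependA γ P) ++ diaAL ξ (prependA η Q) ++ diaAL ξ (prependA (γ ◆ η) (X ⋆ Y))
      ≈⟨ ++-cong (new-first-letter γ P ξγ≋p)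
                 (++-cong (new-first-letter η Q ξη≋q) (new-first-letter (γ ◆ η) (X ⋆ Y) ξγη≋t)) ⟩
    prependA p P ++ prependA q Q ++ prependA t (X ⋆ Y) ∎
    where
    open Wd.≋-Reasoning
    D = diaAL-linearʳ ξ
    P = X ⋆ prependA η Y
    Q = prependA γ X ⋆ Y
    new-first-letter : ∀ ζ Z {o} → ξ ◆ ζ L.≋ o → diaAL ξ (prependA ζ Z) ≋ prependA o Z
    new-first-letter ζ Z ξζ≋o = ≋-trans (diaAL-prependA ξ ζ Z) (prependA-congˡ Z ξζ≋o)

  diaAL-unit⋆prependA : ∀ ξ η Y {p} → ξ ◆ η L.≋ p → diaAL ξ ([ [] ] ⋆ prependA η Y) ≋ prependA p ([ [] ] ⋆ Y)
  diaAL-unit⋆prependA ξ η Y {p} ξη≋p = begin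
    diaAL ξ ([ [] ] ⋆ prependA η Y)   ≈⟨ diaAL-congʳ ξ (⋆-identityˡ (prependA η Y)) ⟩
    diaAL ξ (prependA η Y)            ≈⟨ diaAL-prependA ξ η Y ⟩
    prependA (ξ ◆ η) Y                ≈⟨ prependA-congˡ Y ξη≋p ⟩
    prependA p Y                      ≈⟨ prependA-congʳ p (⋆-identityˡ Y) ⟨
    prependA p ([ [] ] ⋆ Y)           ∎
    where open Wd.≋-Reasoning

  diaAL-prependA⋆unit : ∀ ξ η X {p} → ξ ◆ η L.≋ p → diaAL ξ (prependA η X ⋆ [ [] ]) ≋ prependA p (X ⋆ [ [] ])
  diaAL-prependA⋆unit ξ η X {p} ξη≋p = begin
    diaAL ξ (prependA η X ⋆ [ [] ])   ≈⟨ diaAL-congʳ ξ (⋆-identityʳ (prependA η X)) ⟩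
    diaAL ξ (prependA η X)            ≈⟨ diaAL-prependA ξ η X ⟩
    prependA (ξ ◆ η) X                ≈⟨ prependA-congˡ X ξη≋p ⟩
    prependA p X                      ≈⟨ prependA-congʳ p (⋆-identityʳ X) ⟨
    prependA p (X ⋆ [ [] ])           ∎
    where open Wd.≋-Reasoning

  -- The map Σ^s.  Splitting the compositions of ℓ(a w) according to whether
  -- the first part is 1 or larger gives the recursion
  --     Σ^s(a w) = a Σ^s(w) + s · a ◇ Σ^s(w).

  Σterm : Carrier → Word → List ℕ → Lin
  Σterm s w I = scale (s ^ (length w ∸ length I)) (applyComp I w)

  enlargeHead : List ℕ → List (List ℕ)
  enlargeHead []      = []
  enlargeHead (i ∷ I) = (suc i ∷ I) ∷ []

  compositions-suc : ∀ n → compositions (suc n)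
                           ≡ map (1 ∷_) (compositions n) ++ concatMap enlargeHead (compositions n)
  compositions-suc n = ≡.cong (map (1 ∷_) (compositions n) ++_)
                              (LP.concatMap-cong (λ { [] → ≡.refl ; (i ∷ I) → ≡.refl }) (compositions n))

  Admissible : ℕ → List ℕ → Set
  Admissible n []      = ⊤
  Admissible n (i ∷ J) = 1 Nat.≤ i × suc (length J) Nat.≤ n

  compositions-admissible : ∀ n → All (Admissible n) (compositions n)
  compositions-admissible zero    = tt ∷ []
  compositions-admissible (suc n) rewrite compositions-suc n =
    AllP.++⁺ (one-first (compositions n) (compositions-admissible n))
             (enlarged (compositions n) (compositions-admissible n))
    where
    one-first : ∀ C → All (Admissible n) C → All (Admissible (suc n)) (map (1 ∷_) C)
    one-first []            []                    = []
    one-first ([] ∷ C)      (_ ∷ adm)             = (Nat.s≤s Nat.z≤n , Nat.s≤s Nat.z≤n) ∷ one-first C adm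
    one-first ((i ∷ J) ∷ C) ((_ , |J|<n) ∷ adm)   = (Nat.s≤s Nat.z≤n , Nat.s≤s |J|<n) ∷ one-first C adm
    enlarged : ∀ C → All (Admissible n) C → All (Admissible (suc n)) (concatMap enlargeHead C)
    enlarged []            []                  = []
    enlarged ([] ∷ C)      (_ ∷ adm)           = enlarged C adm
    enlarged ((i ∷ J) ∷ C) ((_ , |J|<n) ∷ adm) = (Nat.s≤s Nat.z≤n , NatP.m≤n⇒m≤1+n |J|<n) ∷ enlarged C adm

  concatMap-concatMap : ∀ (g : List ℕ → Lin) (h : List ℕ → List (List ℕ)) C →
                        concatMap g (concatMap h C) ≡ concatMap (λ I → concatMap g (h I)) C
  concatMap-concatMap g h []      = ≡.refl
  concatMap-concatMap g h (I ∷ C) = ≡.trans (LP.concatMap-++ g (h I) (concatMap h C))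
                                            (≡.cong (concatMap g (h I) ++_) (concatMap-concatMap g h C))

  concatMap-cong-All : ∀ {g g′ : List ℕ → Lin} {C} → All (λ I → g I ≋ g′ I) C → concatMap g C ≋ concatMap g′ C
  concatMap-cong-All []         = ≋-refl
  concatMap-cong-All (e ∷ es) = ++-cong e (concatMap-cong-All es)

  concatMap-linear : ∀ {G} → WW.Linear G → ∀ (g : List ℕ → Lin) C → G (concatMap g C) ≋ concatMap (λ I → G (g I)) C
  concatMap-linear G-lin g []      = WW.Linear.zero-homo G-lin
  concatMap-linear G-lin g (I ∷ C) = ≋-trans (WW.Linear.++-homo G-lin (g I) _) (++-cong ≋-refl (concatMap-linear G-lin g C))

  Σterm-one : ∀ s a w I → Σterm s (a ∷ w) (1 ∷ I) ≋ prepend a (Σterm s w I)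
  Σterm-one s a w I = ≋-trans (≋-reflexive (scale≡· _ _))
    (≋-trans (·-congʳ _ (≋-sym (prepend≋prependA a (applyComp I w))))
             (≋-reflexive (≡.sym (≡.trans (≡.cong (prepend a) (scale≡· _ _)) (prepend-· a _ _)))))
    where
    prepend-· : ∀ x k X → prepend x (k · X) ≡ k · prepend x X
    prepend-· x k []      = ≡.refl
    prepend-· x k (p ∷ X) = ≡.cong (_ ∷_) (prepend-· x k X)

  -- enlarging the first part merges the first letter into the first block
  Σterm-enlarge : ∀ s a w I → Admissible (length w) I →
                  concatMap (Σterm s (a ∷ w)) (enlargeHead I) ≋ s · diaAL L.[ a ] (Σterm s w I)
  Σterm-enlarge s a w [] _ = ≋-sym (·-congʳ s (≋-trans (diaAL-congʳ L.[ a ] (≋-reflexive (scale≡· k [ [] ])))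
    (≋-trans (WW.Linear.·-homo (diaAL-linearʳ L.[ a ]) k [ [] ]) (·-congʳ k (diaAL-unit L.[ a ])))))
    where k = s ^ (length w ∸ 0)
  Σterm-enlarge s a []      (suc i ∷ J) (_ , ())
  Σterm-enlarge s a (y ∷ w) (suc i ∷ J) (_ , Nat.s≤s |J|≤|w|) = begin
    concatMap (Σterm s (a ∷ y ∷ w)) ((suc (suc i) ∷ J) ∷ [])
      ≡⟨ ≡.trans (LP.++-identityʳ _) (scale≡· _ (prependA (L.[ a ] ◆ β) rest)) ⟩
    s ^ (suc (length w) ∸ length J) · prependA (L.[ a ] ◆ β) rest
      ≡⟨ ≡.cong (λ n → s ^ n · prependA (L.[ a ] ◆ β) rest) (NatP.+-∸-assoc 1 |J|≤|w|) ⟩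
    (s * s ^ m) · prependA (L.[ a ] ◆ β) rest
      ≈⟨ Wd.·-assoc s (s ^ m) _ ⟨
    s · s ^ m · prependA (L.[ a ] ◆ β) rest
      ≈⟨ ·-congʳ s (·-congʳ (s ^ m) (diaAL-prependA L.[ a ] β rest)) ⟨
    s · s ^ m · diaAL L.[ a ] (prependA β rest)
      ≈⟨ ·-congʳ s (WW.Linear.·-homo (diaAL-linearʳ L.[ a ]) (s ^ m) (prependA β rest)) ⟨
    s · diaAL L.[ a ] (s ^ m · prependA β rest)
      ≈⟨ ·-congʳ s (diaAL-congʳ L.[ a ] (≋-reflexive (scale≡· (s ^ m) (prependA β rest)))) ⟨
    s · diaAL L.[ a ] (Σterm s (y ∷ w) (suc i ∷ J)) ∎
    where
    open Wd.≋-Reasoning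
    β    = block (y ∷ proj₁ (splitAt i w))
    rest = applyComp J (proj₂ (splitAt i w))
    m    = length w ∸ length J

  Σw-cons : ∀ s a w → Σw s (a ∷ w) ≋ prepend a (Σw s w) ++ s · diaAL L.[ a ] (Σw s w)
  Σw-cons s a w = begin
    Σw s (a ∷ w)
      ≡⟨ ≡.trans (≡.cong (concatMap (Σterm s (a ∷ w))) (compositions-suc (length w)))
                 (LP.concatMap-++ (Σterm s (a ∷ w)) (map (1 ∷_) C) (concatMap enlargeHead C)) ⟩
    concatMap (Σterm s (a ∷ w)) (map (1 ∷_) C) ++ concatMap (Σterm s (a ∷ w)) (concatMap enlargeHead C)
      ≈⟨ ++-cong first-part-one first-part-enlarged ⟩
    prepend a (Σw s w) ++ s · diaAL L.[ a ] (Σw s w) ∎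
    where
    open Wd.≋-Reasoning
    C = compositions (length w)
    first-part-one : concatMap (Σterm s (a ∷ w)) (map (1 ∷_) C) ≋ prepend a (Σw s w)
    first-part-one = ≋-trans (≋-reflexive (LP.concatMap-map (Σterm s (a ∷ w)) (1 ∷_) C))
      (≋-trans (concatMap-cong-All (All.tabulate {xs = C} (λ {I} _ → Σterm-one s a w I)))
               (≋-sym (concatMap-linear (prepend-linear a) (Σterm s w) C)))
    first-part-enlarged : concatMap (Σterm s (a ∷ w)) (concatMap enlargeHead C) ≋ s · diaAL L.[ a ] (Σw s w)
    first-part-enlarged = ≋-trans (≋-reflexive (concatMap-concatMap (Σterm s (a ∷ w)) enlargeHead C))
      (≋-trans (concatMap-cong-All (All.map (λ {I} → Σterm-enlarge s a w I) (compositions-admissible (length w))))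
               (≋-sym (concatMap-linear (WW.linear-· s (diaAL-linearʳ L.[ a ])) (Σterm s w) C)))

  Σw-unit : ∀ s → Σw s [] ≋ [ [] ]
  Σw-unit s = Wd.∷-cong (*-identityˡ 1#) ≋-refl

  Σ^-unit : ∀ s → Σ^ s [ [] ] ≋ [ [] ]
  Σ^-unit s = ≋-trans (Σ^-basis s []) (Σw-unit s)

  Σ^-prependA : ∀ s ξ X → Σ^ s (prependA ξ X) ≋ prependA ξ (Σ^ s X) ++ s · diaAL ξ (Σ^ s X)
  Σ^-prependA s ξ X =
    AW.linear-ext (AWW.linear-∘ (prependA-linearˡ X) (Σ^-linear s))
                  (AW.linear-++ (prependA-linearˡ (Σ^ s X)) (AW.linear-· s (diaAL-linearˡ (Σ^ s X))))
      (λ a → WW.linear-ext (WWW.linear-∘ (prependA-linearʳ L.[ a ]) (Σ^-linear s))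
                           (WW.linear-++ (WWW.linear-∘ (Σ^-linear s) (prependA-linearʳ L.[ a ]))
                                         (WW.linear-· s (WWW.linear-∘ (Σ^-linear s) (diaAL-linearʳ L.[ a ]))))
                           (on-words a) X) ξ
    where
    open Wd.≋-Reasoning
    on-words : ∀ a w → Σ^ s (prependA L.[ a ] [ w ])
                       ≋ prependA L.[ a ] (Σ^ s [ w ]) ++ s · diaAL L.[ a ] (Σ^ s [ w ])
    on-words a w = begin
      Σ^ s (prependA L.[ a ] [ w ])         ≈⟨ Σ^-cong s (≋-sym (prepend≋prependA a [ w ])) ⟩
      Σ^ s [ a ∷ w ]                        ≈⟨ Σ^-basis s (a ∷ w) ⟩
      Σw s (a ∷ w)                          ≈⟨ Σw-cons s a w ⟩
      prepend a (Σw s w) ++ s · diaAL L.[ a ] (Σw s w)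
        ≈⟨ ++-cong (≋-trans (prepend-cong a (≋-sym (Σ^-basis s w))) (prepend≋prependA a (Σ^ s [ w ])))
                   (·-congʳ s (diaAL-congʳ L.[ a ] (≋-sym (Σ^-basis s w)))) ⟩
      prependA L.[ a ] (Σ^ s [ w ]) ++ s · diaAL L.[ a ] (Σ^ s [ w ]) ∎

  module Laws (◇-comm  : ∀ x y → (x ◇ y) ≈A (y ◇ x))
              (◇-assoc : ∀ x y z → diaA (x ◇ y) L.[ z ] ≈A diaA L.[ x ] (y ◇ z)) where

    ◆-comm : ∀ p q → p ◆ q L.≋ q ◆ p
    ◆-comm p q = AA.linear-ext (diaA-linearˡ q) (diaA-linearʳ q)
      (λ x → AA.linear-ext (diaA-linearʳ L.[ x ]) (diaA-linearˡ L.[ x ]) (on-letters x) q) p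
      where
      on-letters : ∀ x y → L.[ x ] ◆ L.[ y ] L.≋ L.[ y ] ◆ L.[ x ]
      on-letters x y = L.≋-trans (diaA-basis x y) (L.≋-trans (≈A⇒≋ (◇-comm x y)) (L.≋-sym (diaA-basis y x)))

    ◆-assoc : ∀ p q t → (p ◆ q) ◆ t L.≋ p ◆ (q ◆ t)
    ◆-assoc p q t =
      AA.linear-ext (AAA.linear-∘ (diaA-linearˡ q) (diaA-linearˡ t)) (diaA-linearˡ (q ◆ t))
        (λ x → AA.linear-ext (AAA.linear-∘ (diaA-linearʳ L.[ x ]) (diaA-linearˡ t))
                             (AAA.linear-∘ (diaA-linearˡ t) (diaA-linearʳ L.[ x ]))
          (λ y → AA.linear-ext (diaA-linearʳ (L.[ x ] ◆ L.[ y ]))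
                               (AAA.linear-∘ (diaA-linearʳ L.[ y ]) (diaA-linearʳ L.[ x ]))
                               (on-letters x y) t) q) p
      where
      on-letters : ∀ x y z → (L.[ x ] ◆ L.[ y ]) ◆ L.[ z ] L.≋ L.[ x ] ◆ (L.[ y ] ◆ L.[ z ])
      on-letters x y z = L.≋-trans (◆-congˡ L.[ z ] (diaA-basis x y))
                        (L.≋-trans (≈A⇒≋ (◇-assoc x y z)) (◆-congʳ L.[ x ] (L.≋-sym (diaA-basis y z))))

    ◆-left-comm : ∀ p q t → q ◆ (p ◆ t) L.≋ p ◆ (q ◆ t)
    ◆-left-comm p q t = L.≋-trans (L.≋-sym (◆-assoc q p t))
                          (L.≋-trans (◆-congˡ t (◆-comm q p)) (◆-assoc p q t))

    ◆-right-comm : ∀ p q t → (p ◆ q) ◆ t L.≋ (p ◆ t) ◆ q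
    ◆-right-comm p q t = L.≋-trans (◆-assoc p q t)
                           (L.≋-trans (◆-congʳ p (◆-comm q t)) (L.≋-sym (◆-assoc p t q)))

    ◆-interchange : ∀ p q t s → (p ◆ q) ◆ (t ◆ s) L.≋ (p ◆ t) ◆ (q ◆ s)
    ◆-interchange p q t s = L.≋-trans (◆-assoc p q (t ◆ s))
      (L.≋-trans (◆-congʳ p (◆-left-comm t q s)) (L.≋-sym (◆-assoc p t (q ◆ s))))

    diaAL-diaAL : ∀ ξ η X → diaAL ξ (diaAL η X) ≋ diaAL (ξ ◆ η) X
    diaAL-diaAL ξ η = WW.linear-ext (WWW.linear-∘ (diaAL-linearʳ η) (diaAL-linearʳ ξ)) (diaAL-linearʳ (ξ ◆ η)) on-words
      where
      open Wd.≋-Reasoning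
      on-words : ∀ u → diaAL ξ (diaAL η [ u ]) ≋ diaAL (ξ ◆ η) [ u ]
      on-words [] = begin
        diaAL ξ (diaAL η [ [] ])   ≈⟨ diaAL-congʳ ξ (diaAL-unit η) ⟩
        diaAL ξ []                 ≈⟨ WW.Linear.zero-homo (diaAL-linearʳ ξ) ⟩
        []                         ≈⟨ diaAL-unit (ξ ◆ η) ⟨
        diaAL (ξ ◆ η) [ [] ]       ∎
      on-words (e ∷ u) = begin
        diaAL ξ (diaAL η [ e ∷ u ])                   ≈⟨ diaAL-congʳ ξ (diaAL-congʳ η (prepend≋prependA e [ u ])) ⟩
        diaAL ξ (diaAL η (prependA L.[ e ] [ u ]))   ≈⟨ diaAL-congʳ ξ (diaAL-prependA η L.[ e ] [ u ]) ⟩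
        diaAL ξ (prependA (η ◆ L.[ e ]) [ u ])       ≈⟨ diaAL-prependA ξ (η ◆ L.[ e ]) [ u ] ⟩
        prependA (ξ ◆ (η ◆ L.[ e ])) [ u ]           ≈⟨ prependA-congˡ [ u ] (◆-assoc ξ η L.[ e ]) ⟨
        prependA ((ξ ◆ η) ◆ L.[ e ]) [ u ]           ≈⟨ diaAL-prependA (ξ ◆ η) L.[ e ] [ u ] ⟨
        diaAL (ξ ◆ η) (prependA L.[ e ] [ u ])       ≈⟨ diaAL-congʳ (ξ ◆ η) (prepend≋prependA e [ u ]) ⟨
        diaAL (ξ ◆ η) [ e ∷ u ]                      ∎

    Σ^-diaAL : ∀ s ξ X → Σ^ s (diaAL ξ X) ≋ diaAL ξ (Σ^ s X)
    Σ^-diaAL s ξ = WW.linear-ext (WWW.linear-∘ (diaAL-linearʳ ξ) (Σ^-linear s))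
                                 (WWW.linear-∘ (Σ^-linear s) (diaAL-linearʳ ξ)) on-words
      where
      open Wd.≋-Reasoning
      on-words : ∀ u → Σ^ s (diaAL ξ [ u ]) ≋ diaAL ξ (Σ^ s [ u ])
      on-words [] = begin
        Σ^ s (diaAL ξ [ [] ])    ≈⟨ Σ^-cong s (diaAL-unit ξ) ⟩
        Σ^ s []                  ≈⟨ WW.Linear.zero-homo (Σ^-linear s) ⟩
        []                       ≈⟨ diaAL-unit ξ ⟨
        diaAL ξ [ [] ]           ≈⟨ diaAL-congʳ ξ (Σ^-unit s) ⟨
        diaAL ξ (Σ^ s [ [] ])    ∎
      on-words (e ∷ u) = begin
        Σ^ s (diaAL ξ [ e ∷ u ])
          ≈⟨ Σ^-cong s (≋-trans (diaAL-congʳ ξ (prepend≋prependA e [ u ])) (diaAL-prependA ξ L.[ e ] [ u ])) ⟩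
        Σ^ s (prependA (ξ ◆ L.[ e ]) [ u ])
          ≈⟨ Σ^-prependA s (ξ ◆ L.[ e ]) [ u ] ⟩
        prependA (ξ ◆ L.[ e ]) Z ++ s · diaAL (ξ ◆ L.[ e ]) Z
          ≈⟨ ++-cong (diaAL-prependA ξ L.[ e ] Z) (·-congʳ s (diaAL-diaAL ξ L.[ e ] Z)) ⟨
        diaAL ξ (prependA L.[ e ] Z) ++ s · diaAL ξ (diaAL L.[ e ] Z)
          ≈⟨ WW.Linear.++·-homo (diaAL-linearʳ ξ) (prependA L.[ e ] Z) s (diaAL L.[ e ] Z) ⟨
        diaAL ξ (prependA L.[ e ] Z ++ s · diaAL L.[ e ] Z)
          ≈⟨ diaAL-congʳ ξ (Σ^-prependA s L.[ e ] [ u ]) ⟨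
        diaAL ξ (Σ^ s (prependA L.[ e ] [ u ]))
          ≈⟨ diaAL-congʳ ξ (Σ^-cong s (prepend≋prependA e [ u ])) ⟨
        diaAL ξ (Σ^ s [ e ∷ u ]) ∎
        where Z = Σ^ s [ u ]

    Σ^-inverse : ∀ s X → Σ^ (- s) (Σ^ s X) ≋ X
    Σ^-inverse s = WW.linear-ext (WWW.linear-∘ (Σ^-linear s) (Σ^-linear (- s))) (Identity.linear-id _≟W_) on-words
      where
      open Wd.≋-Reasoning
      on-words : ∀ u → Σ^ (- s) (Σ^ s [ u ]) ≋ [ u ]
      on-words []      = ≋-trans (Σ^-cong (- s) (Σ^-unit s)) (Σ^-unit (- s))
      on-words (a ∷ w) = begin
        Σ^ (- s) (Σ^ s [ a ∷ w ])
          ≈⟨ Σ^-cong (- s) (≋-trans (Σ^-cong s (prepend≋prependA a [ w ])) (Σ^-prependA s α [ w ])) ⟩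
        Σ^ (- s) (prependA α Z ++ s · diaAL α Z)
          ≈⟨ WW.Linear.++·-homo (Σ^-linear (- s)) (prependA α Z) s (diaAL α Z) ⟩
        Σ^ (- s) (prependA α Z) ++ s · Σ^ (- s) (diaAL α Z)
          ≈⟨ ++-cong (Σ^-prependA (- s) α Z) (·-congʳ s (Σ^-diaAL (- s) α Z)) ⟩
        (prependA α Z′ ++ (- s) · diaAL α Z′) ++ s · diaAL α Z′
          ≈⟨ cancellation ⟩
        prependA α Z′
          ≈⟨ prependA-congʳ α (on-words w) ⟩
        prependA α [ w ]
          ≈⟨ prepend≋prependA a [ w ] ⟨
        [ a ∷ w ] ∎
        where
        α  = L.[ a ]
        Z  = Σ^ s [ w ]
        Z′ = Σ^ (- s) Z
        cancellation : (prependA α Z′ ++ (- s) · diaAL α Z′) ++ s · diaAL α Z′ ≋ prependA α Z′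
        P = prependA α Z′
        D = diaAL α Z′
        cancellation = Wd.≋-coefficientwise ((atom P ⊞ (- s) ⊠ atom D) ⊞ s ⊠ atom D) (atom P) λ v →
          solve 3 (λ p d t → (p :+ (:- t) :* d) :+ t :* d := p) refl (Wd.coeffOf P v) (Wd.coeffOf D v) s

    module Interpolated (r : Carrier) where

      c₁ c₂ : Carrier
      c₁ = 1# - (r + r)
      c₂ = r * r - r

      -- one step of Σ^r:  Σ^r(a v) = S [a] (Σ^r v)
      S : LinA → Lin → Lin
      S ξ V = prependA ξ V ++ r · diaAL ξ V

      S-linear : ∀ ξ → WW.Linear (S ξ)
      S-linear ξ = WW.linear-++ (prependA-linearʳ ξ) (WW.linear-· r (diaAL-linearʳ ξ))

      S-cong : ∀ ξ {V V′} → V ≋ V′ → S ξ V ≋ S ξ V′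
      S-cong ξ = WW.Linear.cong (S-linear ξ)

      S-prependA : ∀ ξ γ X → S ξ (prependA γ X) ≋ prependA ξ (prependA γ X) ++ r · prependA (ξ ◆ γ) X
      S-prependA ξ γ X = ++-cong ≋-refl (·-congʳ r (diaAL-prependA ξ γ X))

      S-unit : ∀ ξ → S ξ [ [] ] ≋ prependA ξ [ [] ]
      S-unit ξ = ≋-trans (++-cong ≋-refl (·-congʳ r (diaAL-unit ξ))) (≋-reflexive (LP.++-identityʳ _))

      -- Σ^r applied to the right-hand side of the defining recursion, expressed
      -- through Σ^r of the three products occurring in it
      G : A → A → Lin → Lin → Lin → Lin
      G x y Z₁ Z₂ Z₃ = S L.[ x ] Z₁ ++ S L.[ y ] Z₂ ++ c₁ · S (x ◇ y) Z₃ ++ c₂ · diaAL (x ◇ y) Z₃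

      G-cong : ∀ x y {Z₁ Z₁′ Z₂ Z₂′ Z₃ Z₃′} → Z₁ ≋ Z₁′ → Z₂ ≋ Z₂′ → Z₃ ≋ Z₃′ →
               G x y Z₁ Z₂ Z₃ ≋ G x y Z₁′ Z₂′ Z₃′
      G-cong x y e₁ e₂ e₃ = ++-cong (S-cong L.[ x ] e₁) (++-cong (S-cong L.[ y ] e₂)
        (++-cong (·-congʳ c₁ (S-cong (x ◇ y) e₃)) (·-congʳ c₂ (diaAL-congʳ (x ◇ y) e₃))))

      -- The key identity (Σ^r turns the recursion into the quasi-shuffle one):
      --   S a V ⋆ S b W = G a b (V ⋆ S b W) (S a V ⋆ W) (V ⋆ W).
      -- Both sides are linear in V and W; on words they are expanded with the
      -- quasi-shuffle recursion, and the resulting coefficient identities hold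
      -- because c₁ = 1 - 2r and c₂ = r² - r.
      KeyL KeyR : A → A → Lin → Lin → Lin
      KeyL x y V W = G x y (V ⋆ S L.[ y ] W) (S L.[ x ] V ⋆ W) (V ⋆ W)
      KeyR x y V W = S L.[ x ] V ⋆ S L.[ y ] W

      S-⋆ : ∀ ξ γ X Q → S ξ (prependA γ X) ⋆ Q ≋ prependA ξ (prependA γ X) ⋆ Q ++ r · (prependA (ξ ◆ γ) X ⋆ Q)
      S-⋆ ξ γ X Q = ≋-trans (WW.Linear.cong (⋆-linearˡ Q) (S-prependA ξ γ X))
                            (WW.Linear.++·-homo (⋆-linearˡ Q) (prependA ξ (prependA γ X)) r (prependA (ξ ◆ γ) X))

      ⋆-S : ∀ P η δ Y → P ⋆ S η (prependA δ Y) ≋ P ⋆ prependA η (prependA δ Y) ++ r · (P ⋆ prependA (η ◆ δ) Y)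
      ⋆-S P η δ Y = ≋-trans (WW.Linear.cong (⋆-linearʳ P) (S-prependA η δ Y))
                            (WW.Linear.++·-homo (⋆-linearʳ P) (prependA η (prependA δ Y)) r (prependA (η ◆ δ) Y))

      prependA-two : ∀ ξ Z₁ Z₂ → prependA ξ (Z₁ ++ r · Z₂) ≋ prependA ξ Z₁ ++ r · prependA ξ Z₂
      prependA-two ξ Z₁ = WW.Linear.++·-homo (prependA-linearʳ ξ) Z₁ r

      diaAL-two : ∀ ξ Z₁ Z₂ → diaAL ξ (Z₁ ++ r · Z₂) ≋ diaAL ξ Z₁ ++ r · diaAL ξ Z₂
      diaAL-two ξ Z₁ = WW.Linear.++·-homo (diaAL-linearʳ ξ) Z₁ r

      three : Lin → Lin → Lin → Wd.LinExpr
      three a b d = atom a ⊞ (atom b ⊞ atom d)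

      three′ : ∀ {n} → Polynomial n → Polynomial n → Polynomial n → Polynomial n
      three′ a b d = a :+ (b :+ d)

      -- The key identity for V = γ X and W = δ Y.  The twelve terms are named
      -- after the pair of tails (V or X, W or Y) of the product they come from.
      module KeyPrefixed (x y : A) (γ δ : LinA) (X Y : Lin) where
        α β : LinA
        α = L.[ x ]
        β = L.[ y ]
        V W : Lin
        V = prependA γ X
        W = prependA δ Y

        vw₁ vw₂ vw₃ vy₁ vy₂ vy₃ xw₁ xw₂ xw₃ xy₁ xy₂ xy₃ : Lin
        vw₁ = prependA α (V ⋆ prependA β W)
        vw₂ = prependA β (prependA α V ⋆ W)
        vw₃ = prependA (α ◆ β) (V ⋆ W)
        vy₁ = prependA α (V ⋆ prependA (β ◆ δ) Y)
        vy₂ = prependA (β ◆ δ) (prependA α V ⋆ Y)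
        vy₃ = prependA (α ◆ (β ◆ δ)) (V ⋆ Y)
        xw₁ = prependA (α ◆ γ) (X ⋆ prependA β W)
        xw₂ = prependA β (prependA (α ◆ γ) X ⋆ W)
        xw₃ = prependA ((α ◆ γ) ◆ β) (X ⋆ W)
        xy₁ = prependA (α ◆ γ) (X ⋆ prependA (β ◆ δ) Y)
        xy₂ = prependA (β ◆ δ) (prependA (α ◆ γ) X ⋆ Y)
        xy₃ = prependA ((α ◆ γ) ◆ (β ◆ δ)) (X ⋆ Y)

        expandedR : Wd.LinExpr
        expandedR = (three vw₁ vw₂ vw₃ ⊞ r ⊠ three xw₁ xw₂ xw₃)
                  ⊞ r ⊠ (three vy₁ vy₂ vy₃ ⊞ r ⊠ three xy₁ xy₂ xy₃)

        expandR : KeyR x y V W ≋ ⟦ expandedR ⟧E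
        expandR = ≋-trans (⋆-S (S α V) β δ Y)
          (++-cong (≋-trans (S-⋆ α γ X (prependA β W))
                            (++-cong (⋆-prependA α β V W) (·-congʳ r (⋆-prependA (α ◆ γ) β X W))))
                   (·-congʳ r (≋-trans (S-⋆ α γ X (prependA (β ◆ δ) Y))
                     (++-cong (⋆-prependA α (β ◆ δ) V Y) (·-congʳ r (⋆-prependA (α ◆ γ) (β ◆ δ) X Y))))))

        fromS-α : S α (V ⋆ S β W)
                  ≋ ⟦ (atom vw₁ ⊞ r ⊠ atom vy₁) ⊞ r ⊠ (three xw₁ vw₃ xw₃ ⊞ r ⊠ three xy₁ vy₃ xy₃) ⟧E
        fromS-α = ≋-trans (S-cong α (⋆-S V β δ Y)) (++-cong (prependA-two α Z₁ Z₂) (·-congʳ r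
          (≋-trans (diaAL-two α Z₁ Z₂)
            (++-cong (diaAL-⋆-prependA α γ β X W L.≋-refl L.≋-refl (L.≋-sym (◆-assoc α γ β)))
                     (·-congʳ r (diaAL-⋆-prependA α γ (β ◆ δ) X Y L.≋-refl L.≋-refl (L.≋-sym (◆-assoc α γ (β ◆ δ)))))))))
          where
          Z₁ = V ⋆ prependA β W
          Z₂ = V ⋆ prependA (β ◆ δ) Y

        fromS-β : S β (S α V ⋆ W)
                  ≋ ⟦ (atom vw₂ ⊞ r ⊠ atom xw₂) ⊞ r ⊠ (three vw₃ vy₂ vy₃ ⊞ r ⊠ three xw₃ xy₂ xy₃) ⟧E
        fromS-β = ≋-trans (S-cong β (S-⋆ α γ X W)) (++-cong (prependA-two β Z₁ Z₂) (·-congʳ r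
          (≋-trans (diaAL-two β Z₁ Z₂)
            (++-cong (diaAL-⋆-prependA β α δ V Y (◆-comm β α) L.≋-refl (◆-left-comm α β δ))
                     (·-congʳ r (diaAL-⋆-prependA β (α ◆ γ) δ X Y (◆-comm β (α ◆ γ)) L.≋-refl (◆-left-comm (α ◆ γ) β δ)))))))
          where
          Z₁ = prependA α V ⋆ W
          Z₂ = prependA (α ◆ γ) X ⋆ W

        fromS-αβ : diaAL (x ◇ y) (V ⋆ W) ≋ ⟦ three xw₃ vy₃ xy₃ ⟧E
        fromS-αβ = ≋-trans (diaAL-congˡ (V ⋆ W) (L.≋-sym (diaA-basis x y)))
          (diaAL-⋆-prependA (α ◆ β) γ δ X Y (◆-right-comm α β γ) (◆-assoc α β δ) (◆-interchange α β γ δ))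

        expandedL : Wd.LinExpr
        expandedL = ((atom vw₁ ⊞ r ⊠ atom vy₁) ⊞ r ⊠ (three xw₁ vw₃ xw₃ ⊞ r ⊠ three xy₁ vy₃ xy₃))
                  ⊞ (((atom vw₂ ⊞ r ⊠ atom xw₂) ⊞ r ⊠ (three vw₃ vy₂ vy₃ ⊞ r ⊠ three xw₃ xy₂ xy₃))
                  ⊞ (c₁ ⊠ (atom vw₃ ⊞ r ⊠ three xw₃ vy₃ xy₃) ⊞ c₂ ⊠ three xw₃ vy₃ xy₃))

        expandL : KeyL x y V W ≋ ⟦ expandedL ⟧E
        expandL = ++-cong fromS-α (++-cong fromS-β (++-cong
          (·-congʳ c₁ (++-cong (prependA-congˡ (V ⋆ W) (L.≋-sym (diaA-basis x y))) (·-congʳ r fromS-αβ)))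
          (·-congʳ c₂ fromS-αβ)))

        coefficients : ∀ w → Wd.coeffE expandedL w ≈ Wd.coeffE expandedR w
        coefficients w =
          solve 13 (λ R vw₁ vw₂ vw₃ vy₁ vy₂ vy₃ xw₁ xw₂ xw₃ xy₁ xy₂ xy₃ →
              ((vw₁ :+ R :* vy₁) :+ R :* (three′ xw₁ vw₃ xw₃ :+ R :* three′ xy₁ vy₃ xy₃))
              :+ (((vw₂ :+ R :* xw₂) :+ R :* (three′ vw₃ vy₂ vy₃ :+ R :* three′ xw₃ xy₂ xy₃))
              :+ ((1ₚ :- (R :+ R)) :* (vw₃ :+ R :* three′ xw₃ vy₃ xy₃) :+ (R :* R :- R) :* three′ xw₃ vy₃ xy₃))
            := (three′ vw₁ vw₂ vw₃ :+ R :* three′ xw₁ xw₂ xw₃)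
               :+ R :* (three′ vy₁ vy₂ vy₃ :+ R :* three′ xy₁ xy₂ xy₃))
            refl r (co vw₁) (co vw₂) (co vw₃) (co vy₁) (co vy₂) (co vy₃)
                   (co xw₁) (co xw₂) (co xw₃) (co xy₁) (co xy₂) (co xy₃)
          where
          co : Lin → Carrier
          co Z = Wd.coeffOf Z w

        key : KeyL x y V W ≋ KeyR x y V W
        key = ≋-trans expandL (≋-trans (Wd.≋-coefficientwise expandedL expandedR coefficients) (≋-sym expandR))

      module KeyUnitLeft (x y : A) (δ : LinA) (Y : Lin) where
        α β : LinA
        α = L.[ x ]
        β = L.[ y ]
        𝟙 W : Lin
        𝟙 = [ [] ]
        W = prependA δ Y

        w₁ w₂ w₃ y₁ y₂ y₃ : Lin
        w₁ = prependA α (𝟙 ⋆ prependA β W)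
        w₂ = prependA β (prependA α 𝟙 ⋆ W)
        w₃ = prependA (α ◆ β) (𝟙 ⋆ W)
        y₁ = prependA α (𝟙 ⋆ prependA (β ◆ δ) Y)
        y₂ = prependA (β ◆ δ) (prependA α 𝟙 ⋆ Y)
        y₃ = prependA (α ◆ (β ◆ δ)) (𝟙 ⋆ Y)

        expandedR expandedL : Wd.LinExpr
        expandedR = three w₁ w₂ w₃ ⊞ r ⊠ three y₁ y₂ y₃
        expandedL = ((atom w₁ ⊞ r ⊠ atom y₁) ⊞ r ⊠ (atom w₃ ⊞ r ⊠ atom y₃))
                  ⊞ ((atom w₂ ⊞ r ⊠ three w₃ y₂ y₃) ⊞ (c₁ ⊠ (atom w₃ ⊞ r ⊠ atom y₃) ⊞ c₂ ⊠ atom y₃))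

        expandR : KeyR x y 𝟙 W ≋ ⟦ expandedR ⟧E
        expandR = ≋-trans (⋆-congˡ (S β W) (S-unit α)) (≋-trans (⋆-S (prependA α 𝟙) β δ Y)
          (++-cong (⋆-prependA α β 𝟙 W) (·-congʳ r (⋆-prependA α (β ◆ δ) 𝟙 Y))))

        fromS-αβ : diaAL (x ◇ y) (𝟙 ⋆ W) ≋ y₃
        fromS-αβ = ≋-trans (diaAL-congˡ (𝟙 ⋆ W) (L.≋-sym (diaA-basis x y)))
                           (diaAL-unit⋆prependA (α ◆ β) δ Y (◆-assoc α β δ))

        expandL : KeyL x y 𝟙 W ≋ ⟦ expandedL ⟧E
        expandL = ++-cong
          (≋-trans (S-cong α (⋆-S 𝟙 β δ Y)) (++-cong (prependA-two α Z₁ Z₂) (·-congʳ r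
            (≋-trans (diaAL-two α Z₁ Z₂) (++-cong (diaAL-unit⋆prependA α β W L.≋-refl)
                                                 (·-congʳ r (diaAL-unit⋆prependA α (β ◆ δ) Y L.≋-refl)))))))
          (++-cong
            (≋-trans (S-cong β (⋆-congˡ W (S-unit α)))
                     (++-cong ≋-refl (·-congʳ r (diaAL-⋆-prependA β α δ 𝟙 Y (◆-comm β α) L.≋-refl (◆-left-comm α β δ)))))
            (++-cong (·-congʳ c₁ (++-cong (prependA-congˡ (𝟙 ⋆ W) (L.≋-sym (diaA-basis x y))) (·-congʳ r fromS-αβ)))
                     (·-congʳ c₂ fromS-αβ)))
          where
          Z₁ = 𝟙 ⋆ prependA β W
          Z₂ = 𝟙 ⋆ prependA (β ◆ δ) Y

        coefficients : ∀ w → Wd.coeffE expandedL w ≈ Wd.coeffE expandedR w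
        coefficients w =
          solve 7 (λ R w₁ w₂ w₃ y₁ y₂ y₃ →
              ((w₁ :+ R :* y₁) :+ R :* (w₃ :+ R :* y₃))
              :+ ((w₂ :+ R :* three′ w₃ y₂ y₃) :+ ((1ₚ :- (R :+ R)) :* (w₃ :+ R :* y₃) :+ (R :* R :- R) :* y₃))
            := three′ w₁ w₂ w₃ :+ R :* three′ y₁ y₂ y₃)
            refl r (co w₁) (co w₂) (co w₃) (co y₁) (co y₂) (co y₃)
          where
          co : Lin → Carrier
          co Z = Wd.coeffOf Z w

        key : KeyL x y 𝟙 W ≋ KeyR x y 𝟙 W
        key = ≋-trans expandL (≋-trans (Wd.≋-coefficientwise expandedL expandedR coefficients) (≋-sym expandR))

      module KeyUnitRight (x y : A) (γ : LinA) (X : Lin) where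
        α β : LinA
        α = L.[ x ]
        β = L.[ y ]
        𝟙 V : Lin
        𝟙 = [ [] ]
        V = prependA γ X

        v₁ v₂ v₃ x₁ x₂ x₃ : Lin
        v₁ = prependA α (V ⋆ prependA β 𝟙)
        v₂ = prependA β (prependA α V ⋆ 𝟙)
        v₃ = prependA (α ◆ β) (V ⋆ 𝟙)
        x₁ = prependA (α ◆ γ) (X ⋆ prependA β 𝟙)
        x₂ = prependA β (prependA (α ◆ γ) X ⋆ 𝟙)
        x₃ = prependA ((α ◆ γ) ◆ β) (X ⋆ 𝟙)

        expandedR expandedL : Wd.LinExpr
        expandedR = three v₁ v₂ v₃ ⊞ r ⊠ three x₁ x₂ x₃
        expandedL = (atom v₁ ⊞ r ⊠ three x₁ v₃ x₃)
                  ⊞ (((atom v₂ ⊞ r ⊠ atom x₂) ⊞ r ⊠ (atom v₃ ⊞ r ⊠ atom x₃))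
                  ⊞ (c₁ ⊠ (atom v₃ ⊞ r ⊠ atom x₃) ⊞ c₂ ⊠ atom x₃))

        expandR : KeyR x y V 𝟙 ≋ ⟦ expandedR ⟧E
        expandR = ≋-trans (⋆-congʳ (S α V) (S-unit β)) (≋-trans (S-⋆ α γ X (prependA β 𝟙))
          (++-cong (⋆-prependA α β V 𝟙) (·-congʳ r (⋆-prependA (α ◆ γ) β X 𝟙))))

        fromS-αβ : diaAL (x ◇ y) (V ⋆ 𝟙) ≋ x₃
        fromS-αβ = ≋-trans (diaAL-congˡ (V ⋆ 𝟙) (L.≋-sym (diaA-basis x y)))
                           (diaAL-prependA⋆unit (α ◆ β) γ X (◆-right-comm α β γ))

        expandL : KeyL x y V 𝟙 ≋ ⟦ expandedL ⟧E
        expandL = ++-cong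
          (≋-trans (S-cong α (⋆-congʳ V (S-unit β)))
                   (++-cong ≋-refl (·-congʳ r (diaAL-⋆-prependA α γ β X 𝟙 L.≋-refl L.≋-refl (L.≋-sym (◆-assoc α γ β))))))
          (++-cong
            (≋-trans (S-cong β (S-⋆ α γ X 𝟙)) (++-cong (prependA-two β Z₁ Z₂) (·-congʳ r
              (≋-trans (diaAL-two β Z₁ Z₂) (++-cong (diaAL-prependA⋆unit β α V (◆-comm β α))
                                                   (·-congʳ r (diaAL-prependA⋆unit β (α ◆ γ) X (◆-comm β (α ◆ γ)))))))))
            (++-cong (·-congʳ c₁ (++-cong (prependA-congˡ (V ⋆ 𝟙) (L.≋-sym (diaA-basis x y))) (·-congʳ r fromS-αβ)))
                     (·-congʳ c₂ fromS-αβ)))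
          where
          Z₁ = prependA α V ⋆ 𝟙
          Z₂ = prependA (α ◆ γ) X ⋆ 𝟙

        coefficients : ∀ w → Wd.coeffE expandedL w ≈ Wd.coeffE expandedR w
        coefficients w =
          solve 7 (λ R v₁ v₂ v₃ x₁ x₂ x₃ →
              (v₁ :+ R :* three′ x₁ v₃ x₃)
              :+ (((v₂ :+ R :* x₂) :+ R :* (v₃ :+ R :* x₃)) :+ ((1ₚ :- (R :+ R)) :* (v₃ :+ R :* x₃) :+ (R :* R :- R) :* x₃))
            := three′ v₁ v₂ v₃ :+ R :* three′ x₁ x₂ x₃)
            refl r (co v₁) (co v₂) (co v₃) (co x₁) (co x₂) (co x₃)
          where
          co : Lin → Carrier
          co Z = Wd.coeffOf Z w

        key : KeyL x y V 𝟙 ≋ KeyR x y V 𝟙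
        key = ≋-trans expandL (≋-trans (Wd.≋-coefficientwise expandedL expandedR coefficients) (≋-sym expandR))

      module KeyUnitBoth (x y : A) where
        α β : LinA
        α = L.[ x ]
        β = L.[ y ]
        𝟙 : Lin
        𝟙 = [ [] ]

        u₁ u₂ u₃ : Lin
        u₁ = prependA α (𝟙 ⋆ prependA β 𝟙)
        u₂ = prependA β (prependA α 𝟙 ⋆ 𝟙)
        u₃ = prependA (α ◆ β) (𝟙 ⋆ 𝟙)

        expandedR expandedL : Wd.LinExpr
        expandedR = three u₁ u₂ u₃
        expandedL = (atom u₁ ⊞ r ⊠ atom u₃)
                  ⊞ ((atom u₂ ⊞ r ⊠ atom u₃) ⊞ (c₁ ⊠ (atom u₃ ⊞ r ⊠ atom []) ⊞ c₂ ⊠ atom []))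

        expandR : KeyR x y 𝟙 𝟙 ≋ ⟦ expandedR ⟧E
        expandR = ≋-trans (⋆-cong (S-unit α) (S-unit β)) (⋆-prependA α β 𝟙 𝟙)

        vanishes : diaAL (x ◇ y) (𝟙 ⋆ 𝟙) ≋ []
        vanishes = ≋-trans (diaAL-congʳ (x ◇ y) (⋆-identityˡ 𝟙)) (diaAL-unit (x ◇ y))

        expandL : KeyL x y 𝟙 𝟙 ≋ ⟦ expandedL ⟧E
        expandL = ++-cong
          (≋-trans (S-cong α (⋆-congʳ 𝟙 (S-unit β)))
                   (++-cong ≋-refl (·-congʳ r (diaAL-unit⋆prependA α β 𝟙 L.≋-refl))))
          (++-cong
            (≋-trans (S-cong β (⋆-congˡ 𝟙 (S-unit α)))
                     (++-cong ≋-refl (·-congʳ r (diaAL-prependA⋆unit β α 𝟙 (◆-comm β α)))))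
            (++-cong (·-congʳ c₁ (++-cong (prependA-congˡ (𝟙 ⋆ 𝟙) (L.≋-sym (diaA-basis x y))) (·-congʳ r vanishes)))
                     (·-congʳ c₂ vanishes)))

        coefficients : ∀ w → Wd.coeffE expandedL w ≈ Wd.coeffE expandedR w
        coefficients w =
          solve 4 (λ R u₁ u₂ u₃ →
              (u₁ :+ R :* u₃) :+ ((u₂ :+ R :* u₃) :+ ((1ₚ :- (R :+ R)) :* (u₃ :+ R :* 0ₚ) :+ (R :* R :- R) :* 0ₚ))
            := three′ u₁ u₂ u₃)
            refl r (co u₁) (co u₂) (co u₃)
          where
          co : Lin → Carrier
          co Z = Wd.coeffOf Z w

        key : KeyL x y 𝟙 𝟙 ≋ KeyR x y 𝟙 𝟙
        key = ≋-trans expandL (≋-trans (Wd.≋-coefficientwise expandedL expandedR coefficients) (≋-sym expandR))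

      G-linear : ∀ x y {f₁ f₂ f₃} → WW.Linear f₁ → WW.Linear f₂ → WW.Linear f₃ →
                 WW.Linear (λ V → G x y (f₁ V) (f₂ V) (f₃ V))
      G-linear x y f₁-lin f₂-lin f₃-lin =
        WW.linear-++ (WWW.linear-∘ f₁-lin (S-linear L.[ x ]))
          (WW.linear-++ (WWW.linear-∘ f₂-lin (S-linear L.[ y ]))
            (WW.linear-++ (WW.linear-· c₁ (WWW.linear-∘ f₃-lin (S-linear (x ◇ y))))
                          (WW.linear-· c₂ (WWW.linear-∘ f₃-lin (diaAL-linearʳ (x ◇ y))))))

      KeyL-linearˡ : ∀ x y W → WW.Linear (λ V → KeyL x y V W)
      KeyL-linearˡ x y W =
        G-linear x y (⋆-linearˡ (S L.[ y ] W)) (WWW.linear-∘ (S-linear L.[ x ]) (⋆-linearˡ W)) (⋆-linearˡ W)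

      KeyL-linearʳ : ∀ x y V → WW.Linear (λ W → KeyL x y V W)
      KeyL-linearʳ x y V =
        G-linear x y (WWW.linear-∘ (S-linear L.[ y ]) (⋆-linearʳ V)) (⋆-linearʳ (S L.[ x ] V)) (⋆-linearʳ V)

      KeyR-linearˡ : ∀ x y W → WW.Linear (λ V → KeyR x y V W)
      KeyR-linearˡ x y W = WWW.linear-∘ (S-linear L.[ x ]) (⋆-linearˡ (S L.[ y ] W))

      KeyR-linearʳ : ∀ x y V → WW.Linear (λ W → KeyR x y V W)
      KeyR-linearʳ x y V = WWW.linear-∘ (S-linear L.[ y ]) (⋆-linearʳ (S L.[ x ] V))

      -- on words: a nonempty word c v is the prefixed combination [c] [v]
      key-words : ∀ x y v w → KeyL x y [ v ] [ w ] ≋ KeyR x y [ v ] [ w ]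
      key-words x y []      []      = KeyUnitBoth.key x y
      key-words x y []      (d ∷ w) =
        ≋-trans (WW.Linear.cong (KeyL-linearʳ x y [ [] ]) (prepend≋prependA d [ w ]))
          (≋-trans (KeyUnitLeft.key x y L.[ d ] [ w ])
                   (≋-sym (WW.Linear.cong (KeyR-linearʳ x y [ [] ]) (prepend≋prependA d [ w ]))))
      key-words x y (c ∷ v) []      =
        ≋-trans (WW.Linear.cong (KeyL-linearˡ x y [ [] ]) (prepend≋prependA c [ v ]))
          (≋-trans (KeyUnitRight.key x y L.[ c ] [ v ])
                   (≋-sym (WW.Linear.cong (KeyR-linearˡ x y [ [] ]) (prepend≋prependA c [ v ]))))
      key-words x y (c ∷ v) (d ∷ w) = begin
        KeyL x y [ c ∷ v ] [ d ∷ w ]            ≈⟨ WW.Linear.cong (KeyL-linearˡ x y [ d ∷ w ]) cv ⟩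
        KeyL x y V [ d ∷ w ]                    ≈⟨ WW.Linear.cong (KeyL-linearʳ x y V) dw ⟩
        KeyL x y V W                            ≈⟨ KeyPrefixed.key x y L.[ c ] L.[ d ] [ v ] [ w ] ⟩
        KeyR x y V W                            ≈⟨ WW.Linear.cong (KeyR-linearʳ x y V) dw ⟨
        KeyR x y V [ d ∷ w ]                    ≈⟨ WW.Linear.cong (KeyR-linearˡ x y [ d ∷ w ]) cv ⟨
        KeyR x y [ c ∷ v ] [ d ∷ w ]            ∎
        where
        open Wd.≋-Reasoning
        V = prependA L.[ c ] [ v ]
        W = prependA L.[ d ] [ w ]
        cv = prepend≋prependA c [ v ]
        dw = prepend≋prependA d [ w ]

      key-identity : ∀ x y V W → KeyL x y V W ≋ KeyR x y V W
      key-identity x y V W = WW.linear-ext (KeyL-linearˡ x y W) (KeyR-linearˡ x y W)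
        (λ v → WW.linear-ext (KeyL-linearʳ x y [ v ]) (KeyR-linearʳ x y [ v ]) (key-words x y v) W) V

      recursion : A → A → Lin → Lin → Lin → Lin
      recursion x y Z₁ Z₂ Z₃ =
        prepend x Z₁ ++ prepend y Z₂ ++ scale c₁ (prependA (x ◇ y) Z₃) ++ scale c₂ (diaAL (x ◇ y) Z₃)

      recursion-cong : ∀ x y {Z₁ Z₁′ Z₂ Z₂′ Z₃ Z₃′} → Z₁ ≋ Z₁′ → Z₂ ≋ Z₂′ → Z₃ ≋ Z₃′ →
                       recursion x y Z₁ Z₂ Z₃ ≋ recursion x y Z₁′ Z₂′ Z₃′
      recursion-cong x y e₁ e₂ e₃ = ++-cong (prepend-cong x e₁) (++-cong (prepend-cong y e₂)
        (++-cong (scale-cong c₁ (prependA-congʳ (x ◇ y) e₃)) (scale-cong c₂ (diaAL-congʳ (x ◇ y) e₃))))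

      Σ^-recursion : ∀ x y Z₁ Z₂ Z₃ → Σ^ r (recursion x y Z₁ Z₂ Z₃) ≋ G x y (Σ^ r Z₁) (Σ^ r Z₂) (Σ^ r Z₃)
      Σ^-recursion x y Z₁ Z₂ Z₃ =
        ≋-trans (T.++-homo (prepend x Z₁) _) (++-cong (Σ^-prepend x Z₁)
        (≋-trans (T.++-homo (prepend y Z₂) _) (++-cong (Σ^-prepend y Z₂)
        (≋-trans (T.++-homo (scale c₁ (prependA (x ◇ y) Z₃)) _)
          (++-cong (≋-trans (Σ^-scale c₁ (prependA (x ◇ y) Z₃)) (·-congʳ c₁ (Σ^-prependA r (x ◇ y) Z₃)))
                   (≋-trans (Σ^-scale c₂ (diaAL (x ◇ y) Z₃)) (·-congʳ c₂ (Σ^-diaAL r (x ◇ y) Z₃))))))))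
        where
        module T = WW.Linear (Σ^-linear r)
        Σ^-prepend : ∀ x Z → Σ^ r (prepend x Z) ≋ S L.[ x ] (Σ^ r Z)
        Σ^-prepend x Z = ≋-trans (Σ^-cong r (prepend≋prependA x Z)) (Σ^-prependA r L.[ x ] Z)
        Σ^-scale : ∀ k Z → Σ^ r (scale k Z) ≋ k · Σ^ r Z
        Σ^-scale k Z = ≋-trans (Σ^-cong r (≋-reflexive (scale≡· k Z))) (T.·-homo k Z)

      Σw-step : ∀ x v → Σw r (x ∷ v) ≋ S L.[ x ] (Σw r v)
      Σw-step x v = ≋-trans (Σw-cons r x v) (++-cong (prepend≋prependA x (Σw r v)) ≋-refl)

      infixl 7 _⊛_
      _⊛_ : Word → Word → Lin
      []      ⊛ w       = [ w ]
      (x ∷ v) ⊛ []      = [ x ∷ v ]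
      (x ∷ v) ⊛ (y ∷ w) = recursion x y (v ⊛ (y ∷ w)) ((x ∷ v) ⊛ w) (v ⊛ w)

      ⊛-identityʳ : ∀ w → w ⊛ [] ≡ [ w ]
      ⊛-identityʳ []      = ≡.refl
      ⊛-identityʳ (x ∷ w) = ≡.refl

      Σ^-⊛ : ∀ u v → Σ^ r (u ⊛ v) ≋ Σw r u ⋆ Σw r v
      Σ^-⊛ [] v = ≋-trans (Σ^-basis r v) (≋-sym (≋-trans (⋆-congˡ (Σw r v) (Σw-unit r)) (⋆-identityˡ (Σw r v))))
      Σ^-⊛ (x ∷ v) [] = ≋-trans (Σ^-basis r (x ∷ v))
        (≋-sym (≋-trans (⋆-congʳ (Σw r (x ∷ v)) (Σw-unit r)) (⋆-identityʳ (Σw r (x ∷ v)))))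
      Σ^-⊛ (a ∷ v) (b ∷ w) = begin
        Σ^ r ((a ∷ v) ⊛ (b ∷ w))
          ≈⟨ Σ^-recursion a b (v ⊛ (b ∷ w)) ((a ∷ v) ⊛ w) (v ⊛ w) ⟩
        G a b (Σ^ r (v ⊛ (b ∷ w))) (Σ^ r ((a ∷ v) ⊛ w)) (Σ^ r (v ⊛ w))
          ≈⟨ G-cong a b (≋-trans (Σ^-⊛ v (b ∷ w)) (⋆-congʳ V (Σw-step b w)))
                        (≋-trans (Σ^-⊛ (a ∷ v) w) (⋆-congˡ W (Σw-step a v)))
                        (Σ^-⊛ v w) ⟩
        G a b (V ⋆ S L.[ b ] W) (S L.[ a ] V ⋆ W) (V ⋆ W)
          ≈⟨ key-identity a b V W ⟩
        S L.[ a ] V ⋆ S L.[ b ] W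
          ≈⟨ ⋆-cong (Σw-step a v) (Σw-step b w) ⟨
        Σw r (a ∷ v) ⋆ Σw r (b ∷ w) ∎
        where
        open Wd.≋-Reasoning
        V = Σw r v
        W = Σw r w

      ⊛≋istar : ∀ u v → u ⊛ v ≋ istar r u v
      ⊛≋istar u v = ≋-sym (≋-trans (Σ^-cong (- r) (≋-sym (Σ^-⊛ u v))) (Σ^-inverse r (u ⊛ v)))

      ⊛-letters : ∀ x y → (x ∷ []) ⊛ (y ∷ []) ≋ [ x ∷ y ∷ [] ] ++ [ y ∷ x ∷ [] ] ++ scale c₁ (liftA (x ◇ y))
      ⊛-letters x y = ++-cong {[ x ∷ y ∷ [] ]} ≋-refl (++-cong {[ y ∷ x ∷ [] ]} ≋-refl
        (≋-trans (++-cong {scale c₁ (liftA (x ◇ y))} ≋-refl (scale-cong c₂ (diaAL-unit (x ◇ y))))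
                 (≋-reflexive (LP.++-identityʳ _))))

      istar-rules : Rules r (istar r)
      istar-rules = record
        { unitˡ   = λ w → ≋⇒≈L (≋-sym (⊛≋istar [] w))
        ; unitʳ   = λ w → ≋⇒≈L (≋-trans (≋-sym (⊛≋istar w [])) (≋-reflexive (⊛-identityʳ w)))
        ; letters = λ x y → ≋⇒≈L (≋-trans (≋-sym (⊛≋istar (x ∷ []) (y ∷ []))) (⊛-letters x y))
        ; recur   = λ x y v w _ → ≋⇒≈L (≋-trans (≋-sym (⊛≋istar (x ∷ v) (y ∷ w)))
                      (recursion-cong x y (⊛≋istar v (y ∷ w)) (⊛≋istar (x ∷ v) w) (⊛≋istar v w)))
        }

      rules-unique : ∀ (P : Word → Word → Lin) → Rules r P → ∀ u v → P u v ≋ u ⊛ v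
      rules-unique P P-rules = go
        where
        open Rules P-rules
        go : ∀ u v → P u v ≋ u ⊛ v
        go []            w             = ≈L⇒≋ (unitˡ w)
        go (x ∷ v)       []            = ≈L⇒≋ (unitʳ (x ∷ v))
        go (x ∷ [])      (y ∷ [])      = ≋-trans (≈L⇒≋ (letters x y)) (≋-sym (⊛-letters x y))
        go (x ∷ c ∷ v)   (y ∷ w)       = ≋-trans (≈L⇒≋ (recur x y (c ∷ v) w λ ()))
          (recursion-cong x y (go (c ∷ v) (y ∷ w)) (go (x ∷ c ∷ v) w) (go (c ∷ v) w))
        go (x ∷ [])      (y ∷ d ∷ w)   = ≋-trans (≈L⇒≋ (recur x y [] (d ∷ w) λ ()))
          (recursion-cong x y (go [] (y ∷ d ∷ w)) (go (x ∷ []) (d ∷ w)) (go [] (d ∷ w)))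

      istar-unique : ∀ (P : Word → Word → Lin) → Rules r P → ∀ u v → P u v ≈L istar r u v
      istar-unique P P-rules u v = ≋⇒≈L (≋-trans (rules-unique P P-rules u v) (⊛≋istar u v))

theorem3 : ∀ {c ℓ a : Level} (F : Field c ℓ) (A : Set a)
             (ι : A → ℕ) (ι-inj : Injective _≡_ _≡_ ι)
             (_◇_ : A → A → List (Field.Carrier F × A)) →
             let open Field F
                 open Interp F A ι ι-inj _◇_
             in (∀ x y → (x ◇ y) ≈A (y ◇ x)) →
                (∀ x y z → diaA (x ◇ y) ((1# , z) ∷ []) ≈A diaA ((1# , x) ∷ []) (y ◇ z)) →
                (r : Carrier) →
                Rules r (istar r)
                × (∀ (P : Word → Word → Lin) → Rules r P → ∀ u v → P u v ≈L istar r u v)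
theorem3 F A ι ι-inj _◇_ ◇-comm ◇-assoc r =
  istar-rules , istar-unique
  where
  open Setting F A ι ι-inj _◇_
  open Laws ◇-comm ◇-assoc
  open Interpolated r
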